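{- Let $q=p^m$ be a prime power and let $\varphi:G_1\to G_2$ be a standard circular Costas map of order $q$. Then $\varphi$ is equivalent to a Costas polynomial $f\in\mathbb{F}_q[x]$ if and only if $G_1$ is cyclic. Moreover, there is a one-to-one correspondence between the set of standard circular Costas maps of order $q$ with cyclic domain (i.e. maps from a fixed cyclic group of order $q-1$ to a fixed group isomorphic to $\mathbb{Z}_p^m$) and the set of Costas polynomials in $\mathbb{F}_q[x]$ of degree at most $q-1$.
   Context: For finite abelian groups $G_1,G_2$ (written additively) with $|G_1|+1=|G_2|$, a map $\varphi:G_1\to G_2$ is circular Costas if $\varphi$ is injective and, for every $k\in G_1\setminus\{0\}$, the map $i\mapsto\varphi(i+k)-\varphi(i)$ is injective; it is standard if $\mathrm{Im}(\varphi)=G_2\setminus\{0\}$. It has order $q=p^m$ if $G_2\cong\mathbb{Z}_p^m$. Maps $\varphi_1:G_1\to G_2$, $\varphi_2:H_1\to H_2$ are equivalent if there are group isomorphisms $\psi_1:G_1\to H_1$, $\psi_2:G_2\to H_2$ with $\varphi_1(x)=y\iff\varphi_2(\psi_1(x))=\psi_2(y)$. A Costas polynomial is a polynomial $f\in\mathbb{F}_q[x]$ with $f(0)=0$ such that $x\mapsto f(dx)-f(x)$ is a permutation of $\mathbb{F}_q$ for every $d\in\mathbb{F}_q$, $d\neq1$. A circular Costas map is said to be equivalent to the Costas polynomial $f$ if it is equivalent to the restriction $f:(\mathbb{F}_q^*,\times)\to(\mathbb{F}_q,+)$, where the domain group is the multiplicative group of $\mathbb{F}_q$. -}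

module Defs where

open import Level using (0ℓ)
open import Data.Nat as ℕ using (ℕ; zero; suc; NonZero)
open import Data.Nat.DivMod using (_%_; m%n<n)
open import Data.Integer using (ℤ; +_; -[1+_])
open import Data.Fin using (Fin; toℕ; fromℕ<)
open import Data.Vec using (Vec; zipWith; toList)
open import Data.List using (List; []; _∷_)
open import Data.Product using (Σ; ∃; ∃-syntax; _×_; _,_; proj₁)
open import Relation.Nullary using (¬_)
open import Relation.Binary using (Setoid; IsEquivalence)
open import Relation.Binary.PropositionalEquality
  using (_≡_; _≢_; refl; sym; trans)
open import Algebra.Structures using (IsAbelianGroup; IsCommutativeRing)
open import Function.Bundles using (_↔_)

Inj : {A B : Set} → (A → B) → Set
Inj f = ∀ x y → f x ≡ f y → x ≡ y

Surj : {A B : Set} → (A → B) → Set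
Surj {B = B} f = ∀ (y : B) → ∃[ x ] f x ≡ y

Bij : {A B : Set} → (A → B) → Set
Bij f = Inj f × Surj f

_⇔′_ : Set → Set → Set
P ⇔′ Q = (P → Q) × (Q → P)

record FinAbGroup : Set₁ where
  infixl 6 _+_ _-_
  field
    Carrier : Set
    _+_     : Carrier → Carrier → Carrier
    0#      : Carrier
    -_      : Carrier → Carrier
    isAbelianGroup : IsAbelianGroup _≡_ _+_ 0# -_
    card    : ℕ
    enum    : Carrier ↔ Fin card

  _-_ : Carrier → Carrier → Carrier
  x - y = x + (- y)

  _·ℕ_ : ℕ → Carrier → Carrier
  zero  ·ℕ g = 0#
  suc n ·ℕ g = g + (n ·ℕ g)

  _·ℤ_ : ℤ → Carrier → Carrier
  (+ n)      ·ℤ g = n ·ℕ g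
  (-[1+ n ]) ·ℤ g = - (suc n ·ℕ g)

⟨_⟩ : FinAbGroup → Set
⟨ G ⟩ = FinAbGroup.Carrier G

Cyclic : FinAbGroup → Set
Cyclic G = ∃[ g ] ∀ (x : ⟨ G ⟩) → ∃[ n ] x ≡ n ·ℤ g
  where open FinAbGroup G

IsCircularCostas : (G₁ G₂ : FinAbGroup) → (⟨ G₁ ⟩ → ⟨ G₂ ⟩) → Set
IsCircularCostas G₁ G₂ φ =
    (FinAbGroup.card G₁ ℕ.+ 1 ≡ FinAbGroup.card G₂)
  × Inj φ
  × (∀ (k : ⟨ G₁ ⟩) → k ≢ G₁.0# →
       Inj (λ i → φ (i G₁.+ k) G₂.- φ i))
  where module G₁ = FinAbGroup G₁
        module G₂ = FinAbGroup G₂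

IsStandard : (G₁ G₂ : FinAbGroup) → (⟨ G₁ ⟩ → ⟨ G₂ ⟩) → Set
IsStandard G₁ G₂ φ = ∀ (y : ⟨ G₂ ⟩) → (y ≢ FinAbGroup.0# G₂) ⇔′ (∃[ x ] φ x ≡ y)

IsStandardCircularCostas : (G₁ G₂ : FinAbGroup) → (⟨ G₁ ⟩ → ⟨ G₂ ⟩) → Set
IsStandardCircularCostas G₁ G₂ φ = IsCircularCostas G₁ G₂ φ × IsStandard G₁ G₂ φ

-- The group ℤ_p^m (as a raw operation on Vec (Fin p) m) and
-- "G ≅ ℤ_p^m": a bijective homomorphism G → ℤ_p^m.

_+mod_ : {n : ℕ} → Fin n → Fin n → Fin n
_+mod_ {suc n} x y = fromℕ< (m%n<n (toℕ x ℕ.+ toℕ y) (suc n))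

_+Zpm_ : {p m : ℕ} → Vec (Fin p) m → Vec (Fin p) m → Vec (Fin p) m
_+Zpm_ = zipWith _+mod_

IsoToZpm : (p m : ℕ) → FinAbGroup → Set
IsoToZpm p m G = Σ (⟨ G ⟩ → Vec (Fin p) m) λ ψ → (Bij ψ × (∀ x y → ψ (x G.+ y) ≡ (ψ x +Zpm ψ y)))
  where module G = FinAbGroup G

-- a circular Costas map φ : G₁ → G₂ has order q = p^m iff G₂ ≅ ℤ_p^m,
-- i.e. IsoToZpm p m G₂.

record FinField : Set₁ where
  infixl 6 _+_ _-_
  infixl 7 _*_
  field
    Carrier : Set
    _+_ _*_ : Carrier → Carrier → Carrier
    -_      : Carrier → Carrier
    0# 1#   : Carrier
    isCommutativeRing : IsCommutativeRing _≡_ _+_ _*_ -_ 0# 1#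
    0≢1     : 0# ≢ 1#
    inverse : ∀ x → x ≢ 0# → ∃[ y ] x * y ≡ 1#
    card    : ℕ
    enum    : Carrier ↔ Fin card

  _-_ : Carrier → Carrier → Carrier
  x - y = x + (- y)

  -- polynomials as coefficient lists a₀ ∷ a₁ ∷ … (Horner evaluation)
  eval : List Carrier → Carrier → Carrier
  eval []       x = 0#
  eval (a ∷ as) x = a + x * eval as x

  IsCostasPoly : List Carrier → Set
  IsCostasPoly f = (eval f 0# ≡ 0#)
                 × (∀ d → d ≢ 1# → Bij (λ x → eval f (d * x) - eval f x))

-- Equivalence of a circular Costas map φ : G₁ → G₂ with the
-- restriction f : (F^*, ×) → (F, +) of a polynomial f.

-- group isomorphism G → (F^*, ×), written as an injective map into F
-- whose image is exactly F ∖ {0}, and which turns + into ×.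
IsMulIso : (G : FinAbGroup) (F : FinField) → (⟨ G ⟩ → FinField.Carrier F) → Set
IsMulIso G F ψ = Inj ψ
               × (∀ x → ψ x ≢ F.0#)
               × (∀ y → y ≢ F.0# → ∃[ x ] ψ x ≡ y)
               × (∀ x y → ψ (x G.+ y) ≡ ψ x F.* ψ y)
  where module G = FinAbGroup G
        module F = FinField F

IsAddIso : (G : FinAbGroup) (F : FinField) → (⟨ G ⟩ → FinField.Carrier F) → Set
IsAddIso G F ψ = Bij ψ × (∀ x y → ψ (x G.+ y) ≡ ψ x F.+ ψ y)
  where module G = FinAbGroup G
        module F = FinField F

EquivToPoly : (G₁ G₂ : FinAbGroup) (F : FinField)
            → (⟨ G₁ ⟩ → ⟨ G₂ ⟩) → List (FinField.Carrier F) → Set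
EquivToPoly G₁ G₂ F φ f =
  ∃[ ψ₁ ] ∃[ ψ₂ ] IsMulIso G₁ F ψ₁ × IsAddIso G₂ F ψ₂
    × (∀ x y → (φ x ≡ y) ⇔′ (F.eval f (ψ₁ x) ≡ ψ₂ y))
  where module F = FinField F

EquivToCostasPoly : (G₁ G₂ : FinAbGroup) (F : FinField)
                  → (⟨ G₁ ⟩ → ⟨ G₂ ⟩) → Set
EquivToCostasPoly G₁ G₂ F φ =
  ∃[ f ] FinField.IsCostasPoly F f × EquivToPoly G₁ G₂ F φ f

StdCostasMaps : (C E : FinAbGroup) → Setoid 0ℓ 0ℓ
StdCostasMaps C E = record
  { Carrier = Σ (⟨ C ⟩ → ⟨ E ⟩) (IsStandardCircularCostas C E)
  ; _≈_ = λ a b → ∀ x → proj₁ a x ≡ proj₁ b x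
  ; isEquivalence = record
      { refl = λ x → refl
      ; sym = λ e x → sym (e x)
      ; trans = λ e e′ x → trans (e x) (e′ x) } }

-- Costas polynomials of degree ≤ q − 1, i.e. coefficient vectors
-- (a₀, …, a_{q−1}); equality = equality of coefficient vectors.
CostasPolysDeg< : (F : FinField) (q : ℕ) → Setoid 0ℓ 0ℓ
CostasPolysDeg< F q = record
  { Carrier = Σ (Vec (FinField.Carrier F) q)
                (λ v → FinField.IsCostasPoly F (toList v))
  ; _≈_ = λ a b → proj₁ a ≡ proj₁ b
  ; isEquivalence = record
      { refl = refl ; sym = sym ; trans = trans } }

{-# OPTIONS --safe #-}
module Submission where

-- Let e be the maximal order of an element g of F*. Every order divides e (otherwise the
-- prime-power parts of two elements combine to an element of larger order), so every
-- element of F is a root of X (X ^ e - 1); counting roots gives q ≤ e + 1, so g generates F*.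
-- The additive group of F is killed by the prime characteristic, so a greedily chosen basis
-- identifies it with ℤ_p^m. Hence for cyclic G₁ there are isomorphisms ψ₁ : G₁ ≅ F* and
-- ψ₂ : G₂ ≅ (F, +), and φ corresponds to h = ψ₂ ∘ φ ∘ ψ₁⁻¹ extended by h 0 = 0: the
-- injectivity of i ↦ φ (i + k) - φ i is that of x ↦ h (d x) - h x for d = ψ₁ k, and the
-- case d = 0 says that φ is standard. Conversely ψ₁ makes G₁ cyclic. Finally every function
-- F → F is a unique polynomial of degree < q: evaluation at the q points is injective on
-- coefficient vectors (a nonzero polynomial of degree < q has fewer than q roots), hence
-- bijective by counting.

open import Defs
open import Data.Nat using (ℕ; _^_; _∸_; _≤_)
open import Data.Nat.Primality using (Prime)
open import Data.Product using (_×_)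
open import Relation.Binary.PropositionalEquality using (_≡_)
open import Function.Bundles using (Bijection)
open import Data.Product using (_,_)


module Counting where

  open import Data.Nat as ℕ using (ℕ; zero; suc; _≤_; _^_)
  import Data.Nat.Properties as ℕ
  open import Data.Fin using (Fin; zero; suc; punchOut)
  open import Data.Fin.Properties using (any?; punchOut-injective; injective⇒≤; *↔×)
  import Data.Fin.Properties as Fin
  open import Data.Vec using (Vec; []; _∷_)
  open import Data.Product using (_×_; _,_; proj₁; proj₂)
  open import Function using (_∘_)
  open import Function.Bundles using (_↔_; Inverse; mk↔ₛ′)
  open import Function.Definitions using (Injective; StrictlySurjective)
  open import Function.Properties.Inverse using (↔-sym; ↔-trans)
  open import Data.Product.Function.NonDependent.Propositional using (_×-↔_)
  open import Relation.Nullary using (yes; no; contradiction)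
  open import Relation.Binary.Definitions using (DecidableEquality)
  open import Relation.Binary.PropositionalEquality

  module Enumeration {A : Set} {n : ℕ} (e : A ↔ Fin n) where
    open Inverse e public using (to; from; strictlyInverseˡ; strictlyInverseʳ)

    to-injective : Injective _≡_ _≡_ to
    to-injective {x} {y} eq =
      trans (sym (strictlyInverseʳ x)) (trans (cong from eq) (strictlyInverseʳ y))

    from-injective : Injective _≡_ _≡_ from
    from-injective {i} {j} eq =
      trans (sym (strictlyInverseˡ i)) (trans (cong to eq) (strictlyInverseˡ j))

    infix 4 _≟_
    _≟_ : DecidableEquality A
    x ≟ y with to x Fin.≟ to y
    ... | yes eq = yes (to-injective eq)
    ... | no neq = no (neq ∘ cong to)

  module _ {A B : Set} {m n : ℕ} (eA : A ↔ Fin m) (eB : B ↔ Fin n) where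
    private
      module EA = Enumeration eA
      module EB = Enumeration eB

    injective⇒card≤ : (f : A → B) → Injective _≡_ _≡_ f → m ≤ n
    injective⇒card≤ f inj =
      injective⇒≤ {f = EB.to ∘ f ∘ EA.from} (EA.from-injective ∘ inj ∘ EB.to-injective)

  fin-injective⇒surjective : ∀ {n} (f : Fin n → Fin n) → Injective _≡_ _≡_ f →
                             StrictlySurjective _≡_ f
  fin-injective⇒surjective {suc n} f inj y with any? (λ x → f x Fin.≟ y)
  ... | yes found = found
  ... | no missed = contradiction (injective⇒≤ f-avoiding-y-injective) ℕ.1+n≰n
    where
    f≢y : ∀ x → y ≢ f x
    f≢y x eq = missed (x , sym eq)
    f-avoiding-y : Fin (suc n) → Fin n
    f-avoiding-y x = punchOut (f≢y x)
    f-avoiding-y-injective : Injective _≡_ _≡_ f-avoiding-y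
    f-avoiding-y-injective {x} {x′} eq = inj (punchOut-injective (f≢y x) (f≢y x′) eq)

  module _ {A B : Set} {n : ℕ} (eA : A ↔ Fin n) (eB : B ↔ Fin n) where
    private
      module EA = Enumeration eA
      module EB = Enumeration eB

    injective⇒surjective : (f : A → B) → Injective _≡_ _≡_ f → StrictlySurjective _≡_ f
    injective⇒surjective f inj y
      with fin-injective⇒surjective (EB.to ∘ f ∘ EA.from)
             (EA.from-injective ∘ inj ∘ EB.to-injective) (EB.to y)
    ... | i , eq = EA.from i , EB.to-injective eq

  bijection⇒card≡ : ∀ {A B : Set} {m n} (eA : A ↔ Fin m) (eB : B ↔ Fin n) (f : A → B) →
                    Injective _≡_ _≡_ f → StrictlySurjective _≡_ f → m ≡ n
  bijection⇒card≡ {A} {B} eA eB f inj surj = ℕ.≤-antisym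
    (injective⇒card≤ eA eB f inj)
    (injective⇒card≤ eB eA section section-injective)
    where
    section : B → A
    section y = proj₁ (surj y)
    section-injective : Injective _≡_ _≡_ section
    section-injective {x} {y} eq = trans (sym (proj₂ (surj x))) (trans (cong f eq) (proj₂ (surj y)))

  Vec↔Fin^ : ∀ {A : Set} {n} → A ↔ Fin n → ∀ k → Vec A k ↔ Fin (n ^ k)
  Vec↔Fin^ e zero = mk↔ₛ′ (λ _ → zero) (λ _ → []) (λ { zero → refl ; (suc ()) }) (λ { [] → refl })
  Vec↔Fin^ e (suc k) = ↔-trans Vec↔× (↔-trans (e ×-↔ Vec↔Fin^ e k) (↔-sym *↔×))
    where
    Vec↔× : ∀ {A : Set} {k} → Vec A (suc k) ↔ (A × Vec A k)
    Vec↔× = mk↔ₛ′ (λ { (x ∷ xs) → x , xs }) (λ { (x , xs) → x ∷ xs })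
                  (λ { (x , xs) → refl }) (λ { (x ∷ xs) → refl })


module PrimePowers where

  open import Data.Nat
  open import Data.Nat.Properties
  open import Data.Nat.Divisibility
  open import Data.Nat.Primality
  open import Data.Nat.Primality.Factorisation using (factorise)
  open import Data.Nat.Coprimality using (Coprime; coprime-divisor)
  open import Data.Nat.Induction using (<-wellFounded)
  open import Induction.WellFounded using (Acc; acc)
  open import Data.List using ([]; _∷_)
  open import Data.Nat.ListAction using (product)
  open import Data.List.Relation.Unary.All using (_∷_)
  open import Data.Product using (∃₂; ∃-syntax; _×_; _,_)
  open import Data.Sum using (_⊎_; inj₁; inj₂)
  open import Relation.Nullary using (¬_; yes; no; contradiction)
  open import Relation.Binary.PropositionalEquality
  open import Relation.Binary.Definitions using (tri<; tri≈; tri>)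

  prime>1 : ∀ {p} → Prime p → 1 < p
  prime>1 {p} pp = nonTrivial⇒n>1 p {{prime⇒nonTrivial pp}}

  ∃-prime-factor : ∀ {n} → 1 < n → ∃[ l ] Prime l × l ∣ n
  ∃-prime-factor {n} 1<n with factorise n {{>-nonZero (<-trans z<s 1<n)}}
  ... | record { factors = [] ; isFactorisation = n≡1 } = contradiction n≡1 (>⇒≢ 1<n)
  ... | record { factors = l ∷ ls ; isFactorisation = n≡l*ls ; factorsPrime = pl ∷ _ } =
    l , pl , divides (product ls) (trans n≡l*ls (*-comm l (product ls)))

  prime∣prime⇒≡ : ∀ {r p} → Prime r → Prime p → r ∣ p → r ≡ p
  prime∣prime⇒≡ pr pp r∣p with prime⇒irreducible pp r∣p
  ... | inj₂ r≡p = r≡p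
  ... | inj₁ refl = contradiction (prime>1 pr) (<-irrefl refl)

  prime∣prime^⇒≡ : ∀ {r p} m → Prime r → Prime p → r ∣ p ^ m → r ≡ p
  prime∣prime^⇒≡ zero    pr pp r∣1 = contradiction (∣1⇒≡1 r∣1) (>⇒≢ (prime>1 pr))
  prime∣prime^⇒≡ {p = p} (suc m) pr pp r∣p^[1+m] with euclidsLemma p (p ^ m) pr r∣p^[1+m]
  ... | inj₁ r∣p   = prime∣prime⇒≡ pr pp r∣p
  ... | inj₂ r∣p^m = prime∣prime^⇒≡ m pr pp r∣p^m

  ^-injectiveʳ : ∀ {p} → 1 < p → ∀ {a b} → p ^ a ≡ p ^ b → a ≡ b
  ^-injectiveʳ {p} 1<p {a} {b} eq with <-cmp a b
  ... | tri≈ _ a≡b _ = a≡b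
  ... | tri< a<b _ _ = contradiction eq (<⇒≢ (^-monoʳ-< p 1<p a<b))
  ... | tri> _ _ b<a = contradiction (sym eq) (<⇒≢ (^-monoʳ-< p 1<p b<a))

  ¬∣⇒coprime-^ : ∀ {l a} k → Prime l → ¬ l ∣ a → Coprime a (l ^ k)
  ¬∣⇒coprime-^ {l} {a} k pl l∤a {zero} (0∣a , _) = contradiction (subst (l ∣_) (sym (0∣⇒≡0 0∣a)) (l ∣0)) l∤a
  ¬∣⇒coprime-^ {l} {a} k pl l∤a {1} _ = refl
  ¬∣⇒coprime-^ {l} {a} k pl l∤a {d@(2+ _)} (d∣a , d∣l^k)
    with ∃-prime-factor {d} (s≤s (s≤s z≤n))
  ... | r , pr , r∣d with prime∣prime^⇒≡ k pr pl (∣-trans r∣d d∣l^k)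
  ... | refl = contradiction (∣-trans r∣d d∣a) l∤a

  coprime∧∣∧∣⇒*∣ : ∀ {a b n} → Coprime a b → a ∣ n → b ∣ n → a * b ∣ n
  coprime∧∣∧∣⇒*∣ {a} {b} coprime (divides t refl) b∣t*a =
    subst (a * b ∣_) (*-comm a t) (*-monoʳ-∣ a b∣t)
    where
    b∣t : b ∣ t
    b∣t = coprime-divisor (Data.Nat.Coprimality.sym coprime) (subst (b ∣_) (*-comm t a) b∣t*a)

  ∣prime^-suc⇒≡⊎∣ : ∀ {l d} b → Prime l → d ∣ l ^ suc b → d ≡ l ^ suc b ⊎ d ∣ l ^ b
  ∣prime^-suc⇒≡⊎∣ {l} {d} b pl d∣ with l ∣? d
  ... | no l∤d with ¬∣⇒coprime-^ (suc b) pl l∤d (∣-refl , d∣)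
  ...   | refl = inj₂ (1∣ _)
  ∣prime^-suc⇒≡⊎∣ {l} {d} b pl d∣ | yes (divides d′ refl) = lift b d′∣l^b
    where
    instance _ = prime⇒nonZero pl
    d′∣l^b : d′ ∣ l ^ b
    d′∣l^b = *-cancelˡ-∣ l (subst (_∣ l ^ suc b) (*-comm d′ l) d∣)
    lift : ∀ c → d′ ∣ l ^ c → d′ * l ≡ l ^ suc c ⊎ d′ * l ∣ l ^ c
    lift zero d′∣1 rewrite ∣1⇒≡1 d′∣1 = inj₁ (trans (*-identityˡ l) (sym (*-identityʳ l)))
    lift (suc c) d′∣ with ∣prime^-suc⇒≡⊎∣ c pl d′∣
    ... | inj₁ d′≡ = inj₁ (trans (cong (_* l) d′≡) (*-comm (l ^ suc c) l))
    ... | inj₂ d′∣′ = inj₂ (subst (d′ * l ∣_) (*-comm (l ^ c) l) (*-monoˡ-∣ l d′∣′))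

  prime-power-split : ∀ {l} → Prime l → ∀ e → .{{NonZero e}} →
                      ∃₂ λ b e′ → e ≡ l ^ b * e′ × ¬ l ∣ e′
  prime-power-split {l} pl e = split e (<-wellFounded e)
    where
    split : ∀ e → Acc _<_ e → .{{NonZero e}} → ∃₂ λ b e′ → e ≡ l ^ b * e′ × ¬ l ∣ e′
    split e (acc rec) with l ∣? e
    ... | no l∤e = 0 , e , sym (+-identityʳ e) , l∤e
    ... | yes (divides e₁@(suc _) refl)
      with split e₁ (rec (m<m*n e₁ l (prime>1 pl)))
    ... | b , e′ , e₁≡ , l∤e′ = suc b , e′ , eq , l∤e′
      where
      eq : e₁ * l ≡ l ^ suc b * e′
      eq = trans (cong (_* l) e₁≡) (trans (*-comm (l ^ b * e′) l) (sym (*-assoc l (l ^ b) e′)))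

  n<m^n : ∀ {m} → 1 < m → ∀ n → n < m ^ n
  n<m^n {m} 1<m zero    = z<s
  n<m^n {m} 1<m (suc n) = begin-strict
    suc n              <⟨ +-monoʳ-< 1 (n<m^n 1<m n) ⟩
    1 + m ^ n          ≤⟨ +-monoˡ-≤ (m ^ n) (m^n>0 m n) ⟩
    m ^ n + m ^ n      ≡⟨ cong (m ^ n +_) (+-identityʳ (m ^ n)) ⟨
    2 * m ^ n          ≤⟨ *-monoˡ-≤ (m ^ n) 1<m ⟩
    m * m ^ n          ∎
    where
    open ≤-Reasoning
    instance _ = >-nonZero (<-trans z<s 1<m)


module Orders where

  open import Level using (0ℓ)
  open import Algebra.Core using (Op₂)
  open import Algebra.Bundles using (CommutativeMonoid)
  open import Algebra.Structures using (IsCommutativeMonoid)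
  open import Data.Nat hiding (_≟_)
  open import Data.Nat.Properties hiding (_≟_)
  open import Data.Nat.DivMod using (_%_; _/_; m≡m%n+[m/n]*n; m%n<n)
  open import Data.Nat.Divisibility
  open import Data.Nat.Primality using (Prime; prime⇒nonZero)
  open import Data.Nat.Coprimality using (Coprime; coprime-divisor)
  open import Data.Nat.Induction using (<-wellFounded)
  open import Induction.WellFounded using (Acc; acc)
  open import Data.Fin using (Fin; toℕ)
  open import Data.Fin.Properties using (pigeonhole; any?)
  open import Data.List using (List; map; allFin)
  open import Data.List.Relation.Unary.All using (lookup)
  open import Data.List.Membership.Propositional using (_∈_)
  open import Data.List.Membership.Propositional.Properties using (∈-map⁺; ∈-allFin)
  import Data.List.Extrema
  open import Data.Product using (∃; ∃₂; ∃-syntax; _×_; _,_; proj₁; proj₂)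
  open import Data.Sum using (_⊎_; inj₁; inj₂)
  open import Function.Bundles using (_↔_)
  open import Relation.Nullary using (¬_; yes; no; contradiction)
  open import Relation.Nullary.Decidable using (map′)
  open import Relation.Unary using (Decidable)
  open import Relation.Binary.Definitions using (tri<; tri≈; tri>)
  open import Relation.Binary.PropositionalEquality
  open Counting
  open PrimePowers

  module _ {P : ℕ → Set} (P? : Decidable P) where

    least-below : ∀ k → (∃[ m ] P m × (∀ {j} → j < m → ¬ P j)) ⊎ (∀ {j} → j < k → ¬ P j)
    least-below zero = inj₂ (λ ())
    least-below (suc k) with least-below k
    ... | inj₁ found = inj₁ found
    ... | inj₂ none with P? k
    ...   | yes pk = inj₁ (k , pk , none)
    ...   | no ¬pk = inj₂ none′
      where
      none′ : ∀ {j} → j < suc k → ¬ P j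
      none′ j<1+k with m≤n⇒m<n∨m≡n (s≤s⁻¹ j<1+k)
      ... | inj₁ j<k = none j<k
      ... | inj₂ refl = ¬pk

    least-witness : ∀ {k} → P k → ∃[ m ] P m × (∀ {j} → j < m → ¬ P j)
    least-witness {k} pk with least-below (suc k)
    ... | inj₁ found = found
    ... | inj₂ none = contradiction pk (none ≤-refl)

  module FiniteCommutativeMonoid
    {A : Set} {_∙_ : Op₂ A} {ε : A}
    (isCommutativeMonoid : IsCommutativeMonoid _≡_ _∙_ ε)
    {n : ℕ} (enum : A ↔ Fin n) where

    commutativeMonoid : CommutativeMonoid 0ℓ 0ℓ
    commutativeMonoid = record { isCommutativeMonoid = isCommutativeMonoid }

    open IsCommutativeMonoid isCommutativeMonoid using (assoc; comm; identityˡ; identityʳ)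
    open import Algebra.Properties.CommutativeSemigroup
      (CommutativeMonoid.commutativeSemigroup commutativeMonoid) using (interchange)
    -- In multiplicative notation  k · x  is the power x ^ k.
    open import Algebra.Properties.CommutativeMonoid.Mult commutativeMonoid public
      using () renaming (_×_ to infixr 8 _·_; ×-homo-+ to ·-homo-+; ×-homo-1 to ·-homo-1;
                         ×-assocˡ to ·-assocˡ; ×-distrib-+ to ·-distrib-∙)
    open Enumeration enum using (_≟_; to; from; to-injective; strictlyInverseʳ)

    ·-ε : ∀ k → k · ε ≡ ε
    ·-ε zero    = refl
    ·-ε (suc k) = trans (identityˡ _) (·-ε k)

    ·-swap : ∀ x a b → a · b · x ≡ b · a · x
    ·-swap x a b = trans (·-assocˡ x a b) (trans (cong (_· x) (*-comm a b)) (sym (·-assocˡ x b a)))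

    ∣⇒·≡ε : ∀ {x a k} → a · x ≡ ε → a ∣ k → k · x ≡ ε
    ∣⇒·≡ε {x} {a} a·x≡ε (divides t refl) =
      trans (sym (·-assocˡ x t a)) (trans (cong (t ·_) a·x≡ε) (·-ε t))

    Invertible : A → Set
    Invertible x = ∃[ y ] x ∙ y ≡ ε

    invertible? : Decidable Invertible
    invertible? x with any? (λ i → (x ∙ from i) ≟ ε)
    ... | yes (i , x∙y≡ε) = yes (from i , x∙y≡ε)
    ... | no none = no λ { (y , x∙y≡ε) → none (to y , trans (cong (x ∙_) (strictlyInverseʳ y)) x∙y≡ε) }

    invertible-ε : Invertible ε
    invertible-ε = ε , identityˡ ε

    invertible-∙ : ∀ {x y} → Invertible x → Invertible y → Invertible (x ∙ y)
    invertible-∙ {x} {y} (x′ , x∙x′≡ε) (y′ , y∙y′≡ε) =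
      x′ ∙ y′ , trans (interchange x y x′ y′) (trans (cong₂ _∙_ x∙x′≡ε y∙y′≡ε) (identityˡ ε))

    invertible-· : ∀ {x} k → Invertible x → Invertible (k · x)
    invertible-· zero    _     = invertible-ε
    invertible-· (suc k) x-inv = invertible-∙ x-inv (invertible-· k x-inv)

    invertible⇒cancelˡ : ∀ {x a b} → Invertible x → x ∙ a ≡ x ∙ b → a ≡ b
    invertible⇒cancelˡ {x} {a} {b} (y , x∙y≡ε) eq = begin
      a             ≡⟨ identityˡ a ⟨
      ε ∙ a         ≡⟨ cong (_∙ a) y∙x≡ε ⟨
      (y ∙ x) ∙ a   ≡⟨ assoc y x a ⟩
      y ∙ (x ∙ a)   ≡⟨ cong (y ∙_) eq ⟩
      y ∙ (x ∙ b)   ≡⟨ assoc y x b ⟨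
      (y ∙ x) ∙ b   ≡⟨ cong (_∙ b) y∙x≡ε ⟩
      ε ∙ b         ≡⟨ identityˡ b ⟩
      b             ∎
      where
      open ≡-Reasoning
      y∙x≡ε : y ∙ x ≡ ε
      y∙x≡ε = trans (comm y x) x∙y≡ε

    ·-period : ∀ {x} → Invertible x → ∀ i d → i · x ≡ (i + d) · x → d · x ≡ ε
    ·-period {x} x-inv i d eq = sym (invertible⇒cancelˡ (invertible-· i x-inv)
      (trans (identityʳ (i · x)) (trans eq (·-homo-+ x i d))))

    ·-mod-period : ∀ {x o} .{{_ : NonZero o}} → o · x ≡ ε → ∀ k → k · x ≡ (k % o) · x
    ·-mod-period {x} {o} o·x≡ε k = begin
      k · x                                ≡⟨ cong (_· x) (m≡m%n+[m/n]*n k o) ⟩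
      (k % o + k / o * o) · x              ≡⟨ ·-homo-+ x (k % o) (k / o * o) ⟩
      ((k % o) · x) ∙ ((k / o * o) · x)    ≡⟨ cong (((k % o) · x) ∙_) (∣⇒·≡ε o·x≡ε (n∣m*n (k / o))) ⟩
      ((k % o) · x) ∙ ε                    ≡⟨ identityʳ _ ⟩
      (k % o) · x                          ∎
      where open ≡-Reasoning

    record _HasOrder_ (x : A) (o : ℕ) : Set where
      field
        order>0 : 0 < o
        ·-order : o · x ≡ ε
        minimal : ∀ {k} → 0 < k → k < o → k · x ≢ ε

    open _HasOrder_ public

    private
      IsPeriod : A → ℕ → Set
      IsPeriod x k = 0 < k × k · x ≡ ε

      isPeriod? : ∀ x → Decidable (IsPeriod x)
      isPeriod? x zero    = no λ ()
      isPeriod? x (suc k) = map′ (z<s ,_) proj₂ (suc k · x ≟ ε)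

      period-exists : ∀ {x} → Invertible x → ∃ (IsPeriod x)
      period-exists {x} x-inv with pigeonhole (n<1+n n) (λ (i : Fin (suc n)) → to (toℕ i · x))
      ... | i , j , i<j , same-power = toℕ j ∸ toℕ i , m<n⇒0<n∸m i<j ,
        ·-period x-inv (toℕ i) (toℕ j ∸ toℕ i)
          (trans (to-injective same-power) (cong (_· x) (sym (m+[n∸m]≡n (<⇒≤ i<j)))))

    order-exists : ∀ {x} → Invertible x → ∃[ o ] x HasOrder o
    order-exists {x} x-inv with least-witness (isPeriod? x) (proj₂ (period-exists x-inv))
    ... | o , (o>0 , o·x≡ε) , below =
      o , record { order>0 = o>0 ; ·-order = o·x≡ε ; minimal = λ k>0 k<o eq → below k<o (k>0 , eq) }

    module _ {x o} (x-order : x HasOrder o) where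
      private instance
        o≢0 : NonZero o
        o≢0 = >-nonZero (order>0 x-order)

      ·-mod-order : ∀ k → k · x ≡ (k % o) · x
      ·-mod-order = ·-mod-period (·-order x-order)

      order-∣ : ∀ {k} → k · x ≡ ε → o ∣ k
      order-∣ {k} k·x≡ε with k % o in k%o≡r
      ... | zero  = m%n≡0⇒n∣m k o k%o≡r
      ... | suc r = contradiction r′·x≡ε (minimal x-order z<s (subst (_< o) k%o≡r (m%n<n k o)))
        where
        r′·x≡ε : suc r · x ≡ ε
        r′·x≡ε = trans (cong (_· x) (sym k%o≡r)) (trans (sym (·-mod-order k)) k·x≡ε)

      distinct-below-order : Invertible x → ∀ {a b} → a < b → b < o → a · x ≢ b · x
      distinct-below-order x-inv {a} {b} a<b b<o eq =
        minimal x-order (m<n⇒0<n∸m a<b) (≤-<-trans (m∸n≤m b a) b<o)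
          (·-period x-inv a (b ∸ a) (trans eq (cong (_· x) (sym (m+[n∸m]≡n (<⇒≤ a<b))))))

      ·-injective-below-order : Invertible x → ∀ {i j} → i < o → j < o → i · x ≡ j · x → i ≡ j
      ·-injective-below-order x-inv {i} {j} i<o j<o eq with <-cmp i j
      ... | tri≈ _ i≡j _ = i≡j
      ... | tri< i<j _ _ = contradiction eq (distinct-below-order x-inv i<j j<o)
      ... | tri> _ _ j<i = contradiction (sym eq) (distinct-below-order x-inv j<i i<o)

      ·≡·⇒%≡% : Invertible x → ∀ {i j} → i · x ≡ j · x → i % o ≡ j % o
      ·≡·⇒%≡% x-inv {i} {j} eq = ·-injective-below-order x-inv (m%n<n i o) (m%n<n j o)
        (trans (sym (·-mod-order i)) (trans eq (·-mod-order j)))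

      %≡%⇒·≡· : ∀ {i j} → i % o ≡ j % o → i · x ≡ j · x
      %≡%⇒·≡· {i} {j} eq = trans (·-mod-order i) (trans (cong (_· x) eq) (sym (·-mod-order j)))

    order-unique : ∀ {x o o′} → x HasOrder o → x HasOrder o′ → o ≡ o′
    order-unique x-order x-order′ =
      ∣-antisym (order-∣ x-order (·-order x-order′)) (order-∣ x-order′ (·-order x-order))

    hasOrder-intro : ∀ {x o} → 0 < o → o · x ≡ ε → (∀ {k} → k · x ≡ ε → o ∣ k) → x HasOrder o
    hasOrder-intro {x} {o} o>0 o·x≡ε divides-periods = record
      { order>0 = o>0
      ; ·-order = o·x≡ε
      ; minimal = λ k>0 k<o k·x≡ε →
          <⇒≱ k<o (∣⇒≤ {{>-nonZero k>0}} (divides-periods k·x≡ε))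
      }

    order-·-quotient : ∀ {x a c} .{{_ : NonZero a}} → x HasOrder (a * c) → (a · x) HasOrder c
    order-·-quotient {x} {a} {c} x-order = hasOrder-intro c>0 c·a·x≡ε c∣
      where
      c>0 : 0 < c
      c>0 = >-nonZero⁻¹ c {{m*n≢0⇒n≢0 a {{>-nonZero (order>0 x-order)}}}}
      c·a·x≡ε : c · a · x ≡ ε
      c·a·x≡ε = trans (·-swap x c a) (trans (·-assocˡ x a c) (·-order x-order))
      c∣ : ∀ {k} → k · a · x ≡ ε → c ∣ k
      c∣ {k} k·a·x≡ε = *-cancelˡ-∣ a (subst (a * c ∣_) (*-comm k a)
                         (order-∣ x-order (trans (sym (·-assocˡ x k a)) k·a·x≡ε)))

    private
      coprime-order-∣ : ∀ {x y a b k} → x HasOrder a → y HasOrder b → Coprime a b →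
                        k · (x ∙ y) ≡ ε → a ∣ k
      coprime-order-∣ {x} {y} {a} {b} {k} x-order y-order coprime k·xy≡ε =
        coprime-divisor coprime (order-∣ x-order b·k·x≡ε)
        where
        open ≡-Reasoning
        y-killed : b · y ≡ ε
        y-killed = ·-order y-order
        b·k·x≡ε : (b * k) · x ≡ ε
        b·k·x≡ε = begin
          (b * k) · x                          ≡⟨ identityʳ _ ⟨
          ((b * k) · x) ∙ ε                    ≡⟨ cong (((b * k) · x) ∙_) (∣⇒·≡ε {a = b} y-killed (m∣m*n k)) ⟨
          ((b * k) · x) ∙ ((b * k) · y)        ≡⟨ ·-distrib-∙ x y (b * k) ⟨
          (b * k) · (x ∙ y)                    ≡⟨ ·-assocˡ (x ∙ y) b k ⟨
          b · k · (x ∙ y)                      ≡⟨ cong (b ·_) k·xy≡ε ⟩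
          b · ε                                ≡⟨ ·-ε b ⟩
          ε                                    ∎

    order-∙-coprime : ∀ {x y a b} → x HasOrder a → y HasOrder b → Coprime a b →
                      (x ∙ y) HasOrder (a * b)
    order-∙-coprime {x} {y} {a} {b} x-order y-order coprime =
      hasOrder-intro (*-pos (order>0 x-order) (order>0 y-order)) ab·xy≡ε ab∣
      where
      *-pos : ∀ {m n} → 0 < m → 0 < n → 0 < m * n
      *-pos m>0 n>0 = >-nonZero⁻¹ _ {{m*n≢0 _ _ {{>-nonZero m>0}} {{>-nonZero n>0}}}}
      ab·xy≡ε : (a * b) · (x ∙ y) ≡ ε
      ab·xy≡ε = trans (·-distrib-∙ x y (a * b))
        (trans (cong₂ _∙_ (∣⇒·≡ε {a = a} (·-order x-order) (m∣m*n b))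
                          (∣⇒·≡ε {a = b} (·-order y-order) (n∣m*n a)))
               (identityˡ ε))
      ab∣ : ∀ {k} → k · (x ∙ y) ≡ ε → a * b ∣ k
      ab∣ {k} k·xy≡ε = coprime∧∣∧∣⇒*∣ coprime
        (coprime-order-∣ x-order y-order coprime k·xy≡ε)
        (coprime-order-∣ y-order x-order (Data.Nat.Coprimality.sym coprime)
           (trans (cong (k ·_) (comm y x)) k·xy≡ε))

    order-prime-power : ∀ {z l} b → Prime l → Invertible z →
                        (l ^ suc b) · z ≡ ε → (l ^ b) · z ≢ ε → z HasOrder (l ^ suc b)
    order-prime-power {z} b pl z-inv L·z≡ε l^b·z≢ε with order-exists z-inv
    ... | o , z-order with ∣prime^-suc⇒≡⊎∣ b pl (order-∣ z-order L·z≡ε)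
    ...   | inj₁ o≡L   = subst (z HasOrder_) o≡L z-order
    ...   | inj₂ o∣l^b = contradiction (∣⇒·≡ε (·-order z-order) o∣l^b) l^b·z≢ε

    record MaximalOrder (g : A) (e : ℕ) : Set where
      field
        g-invertible : Invertible g
        g-order      : g HasOrder e
        bounds-order : ∀ {x o} → Invertible x → x HasOrder o → o ≤ e

    -- If a prime l occurs in the order of x to a higher power than in e, the l-part of x
    -- combined with the l-free part of g has order l * e > e; induction on the order of x
    -- then shows that e kills every invertible x.
    module _ {g e} (g-maximal : MaximalOrder g e) where
      open MaximalOrder g-maximal

      prime*e·x≡ε⇒e·x≡ε : ∀ {l x} → Prime l → Invertible x → (l * e) · x ≡ ε → e · x ≡ ε
      prime*e·x≡ε⇒e·x≡ε {l} {x} pl x-inv l*e·x≡ε with e · x ≟ ε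
      ... | yes e·x≡ε = e·x≡ε
      ... | no e·x≢ε with prime-power-split pl e {{>-nonZero (order>0 g-order)}}
      ...   | b , e′ , e≡l^b*e′ , l∤e′ =
        contradiction (bounds-order (invertible-∙ z-inv w-inv) zw-order) (<⇒≱ e<L*e′)
        where
        L : ℕ
        L = l ^ suc b
        instance
          l^b≢0 : NonZero (l ^ b)
          l^b≢0 = m^n≢0 l b {{prime⇒nonZero pl}}
        L*e′≡l*e : L * e′ ≡ l * e
        L*e′≡l*e = trans (*-assoc l (l ^ b) e′) (cong (l *_) (sym e≡l^b*e′))
        z w : A
        z = e′ · x
        w = (l ^ b) · g
        z-inv : Invertible z
        z-inv = invertible-· e′ x-inv
        w-inv : Invertible w
        w-inv = invertible-· (l ^ b) g-invertible
        z-order : z HasOrder L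
        z-order = order-prime-power b pl z-inv
          (trans (·-assocˡ x L e′) (trans (cong (_· x) L*e′≡l*e) l*e·x≡ε))
          (λ l^b·z≡ε → e·x≢ε (trans (cong (_· x) e≡l^b*e′) (trans (sym (·-assocˡ x (l ^ b) e′)) l^b·z≡ε)))
        w-order : w HasOrder e′
        w-order = order-·-quotient (subst (g HasOrder_) e≡l^b*e′ g-order)
        zw-order : (z ∙ w) HasOrder (L * e′)
        zw-order = order-∙-coprime z-order w-order
          (Data.Nat.Coprimality.sym (¬∣⇒coprime-^ (suc b) pl l∤e′))
        e<L*e′ : e < L * e′
        e<L*e′ = subst (e <_) (trans (*-comm e l) (sym L*e′≡l*e))
                   (m<m*n e l {{>-nonZero (order>0 g-order)}} (prime>1 pl))

      private
        period⇒maximal-order-·≡ε : ∀ {s} → Acc _<_ s → ∀ {x} → Invertible x →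
                                   0 < s → s · x ≡ ε → e · x ≡ ε
        period⇒maximal-order-·≡ε {1} _ {x} _ _ 1·x≡ε = trans (cong (e ·_) x≡ε) (·-ε e)
          where
          x≡ε : x ≡ ε
          x≡ε = trans (sym (·-homo-1 x)) 1·x≡ε
        period⇒maximal-order-·≡ε {s@(2+ _)} (acc rec) {x} x-inv _ s·x≡ε
          with ∃-prime-factor {s} (s≤s (s≤s z≤n))
        ... | l , pl , divides s₁@(suc _) s≡s₁*l = prime*e·x≡ε⇒e·x≡ε pl x-inv l*e·x≡ε
          where
          s₁<s : s₁ < s
          s₁<s = subst (s₁ <_) (sym s≡s₁*l) (m<m*n s₁ l (prime>1 pl))
          e·l·x≡ε : e · l · x ≡ ε
          e·l·x≡ε = period⇒maximal-order-·≡ε (rec s₁<s) (invertible-· l x-inv) z<s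
            (trans (·-assocˡ x s₁ l) (trans (cong (_· x) (sym s≡s₁*l)) s·x≡ε))
          l*e·x≡ε : (l * e) · x ≡ ε
          l*e·x≡ε = trans (cong (_· x) (*-comm l e)) (trans (sym (·-assocˡ x e l)) e·l·x≡ε)

      maximal-order-·≡ε : ∀ {x} → Invertible x → e · x ≡ ε
      maximal-order-·≡ε x-inv with order-exists x-inv
      ... | s , x-order =
        period⇒maximal-order-·≡ε (<-wellFounded s) x-inv (order>0 x-order) (·-order x-order)

    -- The order of an invertible element, and 0 for a non-invertible one.
    orderOf : A → ℕ
    orderOf x with invertible? x
    ... | yes x-inv = proj₁ (order-exists x-inv)
    ... | no _      = 0

    orderOf-hasOrder : ∀ {x} → Invertible x → x HasOrder orderOf x
    orderOf-hasOrder {x} x-inv with invertible? x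
    ... | yes x-inv′ = proj₂ (order-exists x-inv′)
    ... | no ¬x-inv  = contradiction x-inv ¬x-inv

    orderOf>0⇒invertible : ∀ {x} → 0 < orderOf x → Invertible x
    orderOf>0⇒invertible {x} orderOf>0 with invertible? x
    ... | yes x-inv = x-inv
    ... | no _      = contradiction orderOf>0 (<-irrefl refl)

    ∃-maximal-order : ∃₂ MaximalOrder
    ∃-maximal-order = g , orderOf g , record
      { g-invertible = g-inv ; g-order = orderOf-hasOrder g-inv ; bounds-order = maximal }
      where
      open Data.List.Extrema ≤-totalOrder using (argmax; f[⊥]≤f[argmax]; f[xs]≤f[argmax])
      elements : List A
      elements = map from (allFin n)
      g : A
      g = argmax orderOf ε elements
      g-inv : Invertible g
      g-inv = orderOf>0⇒invertible
        (<-≤-trans (order>0 (orderOf-hasOrder invertible-ε)) (f[⊥]≤f[argmax] {f = orderOf} ε elements))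
      maximal : ∀ {x o} → Invertible x → x HasOrder o → o ≤ orderOf g
      maximal {x} x-inv x-order = subst (_≤ orderOf g) (order-unique (orderOf-hasOrder x-inv) x-order)
        (lookup (f[xs]≤f[argmax] {f = orderOf} ε elements) x∈elements)
        where
        x∈elements : x ∈ elements
        x∈elements = subst (_∈ elements) (strictlyInverseʳ x) (∈-map⁺ from (∈-allFin (to x)))


module FieldFacts (F : FinField) where

  open import Level using (0ℓ)
  open import Algebra.Bundles using (CommutativeRing; AbelianGroup)
  open import Data.Nat as ℕ using (ℕ; zero; suc; _≤_; s≤s)
  import Data.Nat.Properties as ℕ
  open import Data.Fin as Fin using (Fin)
  import Data.Fin.Properties as Fin
  open import Data.List using (List; []; _∷_; length)
  open import Data.List.Relation.Unary.All using (All; []; _∷_)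
  open import Data.Vec as Vec using (Vec; []; _∷_; toList; zipWith; tabulate; lookup)
  open import Data.Vec.Properties using (length-toList; lookup∘tabulate)
  open import Data.Product using (∃-syntax; _,_; proj₁; proj₂)
  open import Data.Sum using (_⊎_; inj₁; inj₂)
  open import Function using (_∘_)
  open import Function.Definitions using (Injective)
  open import Relation.Nullary using (yes; no; contradiction)
  open import Relation.Binary.PropositionalEquality
  open Counting

  open FinField F public
  open Enumeration enum public using (_≟_; to; from; strictlyInverseʳ; from-injective)

  commutativeRing : CommutativeRing 0ℓ 0ℓ
  commutativeRing = record { isCommutativeRing = isCommutativeRing }

  open CommutativeRing commutativeRing public
    using ( +-assoc; +-comm; +-identityˡ; +-identityʳ; -‿inverseˡ; -‿inverseʳ
          ; *-assoc; *-comm; *-identityˡ; *-identityʳ; distribˡ; zeroˡ; zeroʳ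
          ; +-abelianGroup; +-isCommutativeMonoid; *-isCommutativeMonoid; semiring )
  open import Algebra.Properties.AbelianGroup +-abelianGroup public
    using (ε⁻¹≈ε; ⁻¹-involutive; ⁻¹-injective; ⁻¹-∙-comm; inverseʳ-unique; x∙y⁻¹≈ε⇒x≈y)
    renaming (∙-cancelˡ to +-cancelˡ)
  open import Algebra.Properties.Ring (CommutativeRing.ring commutativeRing) public
    using (-‿distribʳ-*)

  1≢0 : 1# ≢ 0#
  1≢0 = 0≢1 ∘ sym

  injective⇒bijective : ∀ {f : Carrier → Carrier} → Inj f → Bij f
  injective⇒bijective {f} f-injective = f-injective , injective⇒surjective enum enum f (f-injective _ _)

  *-cancelˡ : ∀ {a b c} → a ≢ 0# → a * b ≡ a * c → b ≡ c
  *-cancelˡ {a} {b} {c} a≢0 eq with inverse a a≢0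
  ... | a′ , a*a′≡1 = begin
    b               ≡⟨ *-identityˡ b ⟨
    1# * b          ≡⟨ cong (_* b) a′*a≡1 ⟨
    a′ * a * b      ≡⟨ *-assoc a′ a b ⟩
    a′ * (a * b)    ≡⟨ cong (a′ *_) eq ⟩
    a′ * (a * c)    ≡⟨ *-assoc a′ a c ⟨
    a′ * a * c      ≡⟨ cong (_* c) a′*a≡1 ⟩
    1# * c          ≡⟨ *-identityˡ c ⟩
    c               ∎
    where
    open ≡-Reasoning
    a′*a≡1 : a′ * a ≡ 1#
    a′*a≡1 = trans (*-comm a′ a) a*a′≡1

  *-≡0 : ∀ {a b} → a * b ≡ 0# → a ≡ 0# ⊎ b ≡ 0#
  *-≡0 {a} {b} a*b≡0 with a ≟ 0#
  ... | yes a≡0 = inj₁ a≡0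
  ... | no a≢0  = inj₂ (*-cancelˡ a≢0 (trans a*b≡0 (sym (zeroʳ a))))

  -- The quotient of f by X - c; the remainder f (c) is dropped.
  divide : Carrier → List Carrier → List Carrier
  divide c []          = []
  divide c (_ ∷ [])    = []
  divide c (_ ∷ b ∷ w) = eval (b ∷ w) c ∷ divide c (b ∷ w)

  length-divide : ∀ c a w → length (divide c (a ∷ w)) ≡ length w
  length-divide c a []      = refl
  length-divide c a (b ∷ w) = cong suc (length-divide c b w)

  eval-divide-∷ : ∀ c a w x → eval (divide c (a ∷ w)) x ≡ eval w c + x * eval (divide c w) x
  eval-divide-∷ c a []      x = sym (trans (+-identityˡ _) (zeroʳ x))
  eval-divide-∷ c a (b ∷ w) x = refl

  -- f(x) - f(c) = (x - c) q(x), with both sides moved so that no subtraction occurs.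
  eval-divide : ∀ c f x → eval f x + c * eval (divide c f) x ≡ x * eval (divide c f) x + eval f c
  eval-divide c []      x = trans (+-identityˡ _) (trans (zeroʳ c) (sym (trans (+-identityʳ _) (zeroʳ x))))
  eval-divide c (a ∷ w) x = begin
    (a + x * W) + c * eval (divide c (a ∷ w)) x
                                           ≡⟨ cong (λ t → (a + x * W) + c * t) (eval-divide-∷ c a w x) ⟩
    (a + x * W) + c * (R + x * Q)          ≡⟨ cong ((a + x * W) +_) (distribˡ c R (x * Q)) ⟩
    (a + x * W) + (c * R + c * (x * Q))    ≡⟨ interchange a (x * W) (c * R) (c * (x * Q)) ⟩
    (a + c * R) + (x * W + c * (x * Q))    ≡⟨ cong (λ t → (a + c * R) + (x * W + t)) (x∙yz≈y∙xz c x Q) ⟩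
    (a + c * R) + (x * W + x * (c * Q))    ≡⟨ cong ((a + c * R) +_) (distribˡ x W (c * Q)) ⟨
    (a + c * R) + x * (W + c * Q)          ≡⟨ cong (λ t → (a + c * R) + x * t) (eval-divide c w x) ⟩
    (a + c * R) + x * (x * Q + R)          ≡⟨ +-comm (a + c * R) (x * (x * Q + R)) ⟩
    x * (x * Q + R) + (a + c * R)          ≡⟨ cong (λ t → x * t + (a + c * R)) (+-comm (x * Q) R) ⟩
    x * (R + x * Q) + (a + c * R)          ≡⟨ cong (λ t → x * t + (a + c * R)) (eval-divide-∷ c a w x) ⟨
    x * eval (divide c (a ∷ w)) x + (a + c * R) ∎
    where
    open ≡-Reasoning
    open import Algebra.Properties.CommutativeSemigroup
      (CommutativeRing.+-commutativeSemigroup commutativeRing) using (interchange)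
    open import Algebra.Properties.CommutativeSemigroup
      (CommutativeRing.*-commutativeSemigroup commutativeRing) using (x∙yz≈y∙xz)
    W Q R : Carrier
    W = eval w x
    Q = eval (divide c w) x
    R = eval w c

  Zero : List Carrier → Set
  Zero = All (_≡ 0#)

  zero-divide⇒zero : ∀ c f → Zero (divide c f) → eval f c ≡ 0# → Zero f
  zero-divide⇒zero c []          _               _         = []
  zero-divide⇒zero c (a ∷ [])    _               a+c*0≡0   =
    trans (sym (+-identityʳ a)) (trans (cong (a +_) (sym (zeroʳ c))) a+c*0≡0) ∷ []
  zero-divide⇒zero c (a ∷ b ∷ w) (w[c]≡0 ∷ zero-q) f[c]≡0 =
    trans (sym (+-identityʳ a)) (trans (cong (a +_) (sym c*w[c]≡0)) f[c]≡0)
      ∷ zero-divide⇒zero c (b ∷ w) zero-q w[c]≡0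
    where
    c*w[c]≡0 : c * eval (b ∷ w) c ≡ 0#
    c*w[c]≡0 = trans (cong (c *_) w[c]≡0) (zeroʳ c)

  root-of-divide : ∀ {c x} f → eval f c ≡ 0# → eval f x ≡ 0# → x ≢ c → eval (divide c f) x ≡ 0#
  root-of-divide {c} {x} f f[c]≡0 f[x]≡0 x≢c with eval (divide c f) x ≟ 0#
  ... | yes q[x]≡0 = q[x]≡0
  ... | no q[x]≢0  = contradiction (*-cancelˡ q[x]≢0 q*x≡q*c) x≢c
    where
    q : Carrier
    q = eval (divide c f) x
    c*q≡x*q : c * q ≡ x * q
    c*q≡x*q = trans (sym (+-identityˡ _))
      (trans (cong (_+ c * q) (sym f[x]≡0))
      (trans (eval-divide c f x) (trans (cong (x * q +_) f[c]≡0) (+-identityʳ _))))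
    q*x≡q*c : q * x ≡ q * c
    q*x≡q*c = trans (*-comm q x) (trans (sym c*q≡x*q) (*-comm c q))

  roots⇒zero : ∀ {k} (f : List Carrier) → length f ≤ k → (r : Fin k → Carrier) →
               Injective _≡_ _≡_ r → (∀ i → eval f (r i) ≡ 0#) → Zero f
  roots⇒zero []      _         _ _     _     = []
  roots⇒zero {suc k} (a ∷ w) (s≤s |w|≤k) r r-inj roots =
    zero-divide⇒zero c (a ∷ w)
      (roots⇒zero (divide c (a ∷ w)) (subst (_≤ k) (sym (length-divide c a w)) |w|≤k)
         (r ∘ Fin.suc) (Fin.suc-injective ∘ r-inj)
         (λ i → root-of-divide (a ∷ w) (roots Fin.zero) (roots (Fin.suc i))
                  (λ eq → Fin.0≢1+n (r-inj (sym eq)))))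
      (roots Fin.zero)
    where
    c = r Fin.zero

  eval-difference : ∀ {k} (u v : Vec Carrier k) x →
                   eval (toList (zipWith _-_ u v)) x ≡ eval (toList u) x - eval (toList v) x
  eval-difference []      []      x = sym (-‿inverseʳ 0#)
  eval-difference (a ∷ u) (b ∷ v) x = begin
    (a - b) + x * eval (toList (zipWith _-_ u v)) x ≡⟨ cong (λ t → (a - b) + x * t) (eval-difference u v x) ⟩
    (a - b) + x * (U - V)                           ≡⟨ cong ((a - b) +_) (distribˡ x U (- V)) ⟩
    (a - b) + (x * U + x * - V)                     ≡⟨ cong (λ t → (a - b) + (x * U + t)) (-‿distribʳ-* x V) ⟨
    (a + - b) + (x * U + - (x * V))                 ≡⟨ interchange a (- b) (x * U) (- (x * V)) ⟩
    (a + x * U) + (- b + - (x * V))                 ≡⟨ cong ((a + x * U) +_) (⁻¹-∙-comm b (x * V)) ⟩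
    (a + x * U) - (b + x * V)                       ∎
    where
    open ≡-Reasoning
    open import Algebra.Properties.CommutativeSemigroup
      (CommutativeRing.+-commutativeSemigroup commutativeRing) using (interchange)
    U V : Carrier
    U = eval (toList u) x
    V = eval (toList v) x

  eval-injective : ∀ (u v : Vec Carrier card) →
                   (∀ x → eval (toList u) x ≡ eval (toList v) x) → u ≡ v
  eval-injective u v same-values = zero-difference u v
    (roots⇒zero (toList (zipWith _-_ u v)) (ℕ.≤-reflexive (length-toList (zipWith _-_ u v)))
       from from-injective
       (λ i → trans (eval-difference u v (from i))
                (trans (cong (_- eval (toList v) (from i)) (same-values (from i))) (-‿inverseʳ _))))
    where
    zero-difference : ∀ {k} (u v : Vec Carrier k) → Zero (toList (zipWith _-_ u v)) → u ≡ v
    zero-difference []      []      _              = refl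
    zero-difference (a ∷ u) (b ∷ v) (a-b≡0 ∷ rest) =
      cong₂ _∷_ (x∙y⁻¹≈ε⇒x≈y a b a-b≡0) (zero-difference u v rest)

  sample : Vec Carrier card → Vec Carrier card
  sample v = tabulate (eval (toList v) ∘ from)

  lookup-tabulate-to : ∀ (h : Carrier → Carrier) x → lookup (tabulate (h ∘ from)) (to x) ≡ h x
  lookup-tabulate-to h x = trans (lookup∘tabulate (h ∘ from) (to x)) (cong h (strictlyInverseʳ x))

  sample-injective : Injective _≡_ _≡_ sample
  sample-injective {u} {v} eq = eval-injective u v λ x →
    trans (sym (lookup-tabulate-to (eval (toList u)) x))
      (trans (cong (λ w → lookup w (to x)) eq) (lookup-tabulate-to (eval (toList v)) x))

  private
    sample-surjective : ∀ w → ∃[ v ] sample v ≡ w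
    sample-surjective = injective⇒surjective (Vec↔Fin^ enum card) (Vec↔Fin^ enum card)
                          sample sample-injective

  interpolate : (Carrier → Carrier) → Vec Carrier card
  interpolate h = proj₁ (sample-surjective (tabulate (h ∘ from)))

  eval-interpolate : ∀ h x → eval (toList (interpolate h)) x ≡ h x
  eval-interpolate h x = begin
    eval (toList (interpolate h)) x          ≡⟨ lookup-tabulate-to (eval (toList (interpolate h))) x ⟨
    lookup (sample (interpolate h)) (to x)   ≡⟨ cong (λ w → lookup w (to x)) (proj₂ (sample-surjective _)) ⟩
    lookup (tabulate (h ∘ from)) (to x)      ≡⟨ lookup-tabulate-to h x ⟩
    h x                                      ∎
    where open ≡-Reasoning


module Units (F : FinField) where

  open import Data.Nat as ℕ using (ℕ; zero; suc; _≤_; _<_)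
  import Data.Nat.Properties as ℕ
  open import Data.Fin as Fin using (Fin; toℕ)
  import Data.Fin.Properties as Fin
  open import Data.List using (List; []; _∷_; length)
  open import Data.List.Relation.Unary.All using (_∷_)
  open import Data.Product using (∃; ∃-syntax; _,_; proj₂)
  open import Function using (_∘_)
  open import Function.Bundles using (_↔_)
  open import Function.Definitions using (Injective; StrictlySurjective)
  open import Function.Properties.Inverse using (↔-refl)
  open import Relation.Nullary using (yes; no; contradiction)
  open import Relation.Binary.PropositionalEquality
  open Counting
  open Orders

  open FieldFacts F
  open FiniteCommutativeMonoid *-isCommutativeMonoid enum public

  nonzero⇒invertible : ∀ {x} → x ≢ 0# → Invertible x
  nonzero⇒invertible = inverse _

  invertible⇒nonzero : ∀ {x} → Invertible x → x ≢ 0#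
  invertible⇒nonzero (y , x*y≡1) refl = 0≢1 (trans (sym (zeroˡ y)) x*y≡1)

  monomial : ℕ → List Carrier
  monomial zero    = 1# ∷ []
  monomial (suc k) = 0# ∷ monomial k

  eval-monomial : ∀ k x → eval (monomial k) x ≡ k · x
  eval-monomial zero    x = trans (cong (1# +_) (zeroʳ x)) (+-identityʳ 1#)
  eval-monomial (suc k) x = trans (+-identityˡ _) (cong (x *_) (eval-monomial k x))

  length-monomial : ∀ k → length (monomial k) ≡ suc k
  length-monomial zero    = refl
  length-monomial (suc k) = cong suc (length-monomial k)

  -- Every element is a root of X (X ^ e - 1), a nonzero polynomial of degree e + 1.
  exponent⇒card≤ : ∀ e → (∀ {x} → x ≢ 0# → e · x ≡ 1#) → 0 < e → card ≤ suc e
  exponent⇒card≤ e@(suc e₀) x^e≡1 _ with card ℕ.≤? suc e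
  ... | yes card≤1+e = card≤1+e
  ... | no card≰1+e = contradiction
        (roots⇒zero P (ℕ.≤-reflexive |P|≡2+e) r r-injective (λ i → root (r i)))
        λ { (_ ∷ -1≡0 ∷ _) → 1≢0 (trans (sym (⁻¹-involutive 1#)) (trans (cong -_ -1≡0) ε⁻¹≈ε)) }
    where
    P : List Carrier
    P = 0# ∷ - 1# ∷ monomial e₀
    |P|≡2+e : length P ≡ suc (suc e)
    |P|≡2+e = cong (suc ∘ suc) (length-monomial e₀)
    2+e≤card : suc (suc e) ≤ card
    2+e≤card = ℕ.≰⇒> card≰1+e
    r : Fin (suc (suc e)) → Carrier
    r i = from (Fin.inject≤ i 2+e≤card)
    r-injective : Injective _≡_ _≡_ r
    r-injective eq = Fin.inject≤-injective _ _ _ _ (from-injective eq)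
    root : ∀ x → eval P x ≡ 0#
    root x with x ≟ 0#
    ... | yes refl = trans (+-identityˡ _) (zeroˡ _)
    ... | no x≢0 = trans (+-identityˡ _) (trans (cong (x *_) -1+x^e≡0) (zeroʳ x))
      where
      -1+x^e≡0 : - 1# + x * eval (monomial e₀) x ≡ 0#
      -1+x^e≡0 = trans (cong (λ t → - 1# + x * t) (eval-monomial e₀ x))
                   (trans (cong (- 1# +_) (x^e≡1 x≢0)) (-‿inverseˡ 1#))

  record PrimitiveElement : Set where
    field
      g            : Carrier
      order        : ℕ
      g-invertible : Invertible g
      g-order      : g HasOrder order
      card≡1+order : card ≡ suc order
      generates    : ∀ {y} → y ≢ 0# → ∃[ i ] i · g ≡ y

  maximal-order⇒primitive : ∀ {g e} → MaximalOrder g e → PrimitiveElement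
  maximal-order⇒primitive {g} {e} g-maximal = record
    { g = g ; order = e ; g-invertible = g-invertible ; g-order = g-order
    ; card≡1+order = card≡1+e ; generates = generates }
    where
    open MaximalOrder g-maximal
    powers : Fin (suc e) → Carrier
    powers Fin.zero    = 0#
    powers (Fin.suc i) = toℕ i · g
    power≢0 : ∀ i → toℕ i · g ≢ 0#
    power≢0 i = invertible⇒nonzero (invertible-· (toℕ i) g-invertible)
    powers-injective : Injective _≡_ _≡_ powers
    powers-injective {Fin.zero}  {Fin.zero}  _  = refl
    powers-injective {Fin.zero}  {Fin.suc j} eq = contradiction (sym eq) (power≢0 j)
    powers-injective {Fin.suc i} {Fin.zero}  eq = contradiction eq (power≢0 i)
    powers-injective {Fin.suc i} {Fin.suc j} eq = cong Fin.suc (Fin.toℕ-injective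
      (·-injective-below-order g-order g-invertible (Fin.toℕ<n i) (Fin.toℕ<n j) eq))
    card≡1+e : card ≡ suc e
    card≡1+e = ℕ.≤-antisym
      (exponent⇒card≤ e (maximal-order-·≡ε g-maximal ∘ nonzero⇒invertible) (order>0 g-order))
      (injective⇒card≤ ↔-refl enum powers powers-injective)
    powers-surjective : StrictlySurjective _≡_ powers
    powers-surjective = injective⇒surjective ↔-refl (subst (λ n → Carrier ↔ Fin n) card≡1+e enum)
                          powers powers-injective
    generates : ∀ {y} → y ≢ 0# → ∃[ i ] i · g ≡ y
    generates {y} y≢0 = nonzero-power (powers-surjective y)
      where
      nonzero-power : ∃ (λ i → powers i ≡ y) → ∃[ i ] i · g ≡ y
      nonzero-power (Fin.zero  , 0≡y) = contradiction (sym 0≡y) y≢0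
      nonzero-power (Fin.suc i , eq)  = toℕ i , eq

  primitive-element : PrimitiveElement
  primitive-element = maximal-order⇒primitive (proj₂ (proj₂ ∃-maximal-order))


module Groups where

  open import Level using (0ℓ)
  open import Algebra.Bundles using (AbelianGroup; CommutativeMonoid)
  open import Algebra.Structures using (IsAbelianGroup)
  open import Data.Nat as ℕ using (ℕ; zero; suc; _*_; _≤_; _<_; _∸_; _^_)
  import Data.Nat.Properties as ℕ
  open import Data.Nat.DivMod using (_%_; m%n<n)
  open import Data.Nat.Coprimality using (coprime-Bézout; prime⇒coprime)
  open import Data.Nat.GCD using (module Bézout)
  open import Data.Nat.Divisibility using (n∣m*n)
  import Data.Nat.Coprimality
  open import Data.Nat.Primality using (Prime)
  open import Data.Fin as Fin using (Fin; toℕ)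
  import Data.Fin.Properties as Fin
  open import Data.Vec using (Vec; []; _∷_; replicate)
  open import Data.Product using (∃-syntax; Σ; _×_; _,_)
  open import Function.Bundles using (Inverse)
  open import Function.Definitions using (Injective; StrictlySurjective)
  open import Function.Properties.Inverse using (↔-refl)
  open import Relation.Nullary using (¬_; Dec; yes; no; contradiction)
  open import Relation.Binary.PropositionalEquality
  open import Relation.Binary.Definitions using (tri<; tri≈; tri>)
  open import Data.Integer using (-[1+_]) renaming (+_ to ℤ+_)
  open Counting
  open PrimePowers
  open Orders

  IsoFromZpm : (p m : ℕ) (G : FinAbGroup) → Set
  IsoFromZpm p m G = Σ (Vec (Fin p) m → ⟨ G ⟩) λ L →
    Injective _≡_ _≡_ L × StrictlySurjective _≡_ L × (∀ u v → L (u +Zpm v) ≡ L u G.+ L v)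
    where module G = FinAbGroup G

  module GroupFacts (G : FinAbGroup) where
    open FinAbGroup G public
    open IsAbelianGroup isAbelianGroup public
      using (assoc; comm; identityˡ; identityʳ; inverseˡ; inverseʳ; isCommutativeMonoid)

    abelianGroup : AbelianGroup 0ℓ 0ℓ
    abelianGroup = record { isAbelianGroup = isAbelianGroup }

    open import Algebra.Properties.AbelianGroup abelianGroup public
      using (∙-cancelˡ; inverseʳ-unique; x∙y⁻¹≈ε⇒x≈y; ⁻¹-involutive; ⁻¹-injective; ε⁻¹≈ε; identityʳ-unique)
    open FiniteCommutativeMonoid isCommutativeMonoid enum public
    open Enumeration enum public using (_≟_; to; from; strictlyInverseʳ)

    invertible : ∀ x → Invertible x
    invertible x = - x , inverseʳ x

    ·ℕ≡· : ∀ k x → k ·ℕ x ≡ k · x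
    ·ℕ≡· zero    x = refl
    ·ℕ≡· (suc k) x = cong (x +_) (·ℕ≡· k x)

    -- A finite abelian group killed by a prime r is a vector space over ℤ_r; a basis is
    -- found greedily, since a vector outside the span of an independent family can be added to it.
    module ElementaryAbelian {s : ℕ} (r-prime : Prime (suc s)) (r·x≡0 : ∀ x → suc s · x ≡ 0#) where

      r : ℕ
      r = suc s

      combination : ∀ {k} → Vec Carrier k → Vec (Fin r) k → Carrier
      combination []       []       = 0#
      combination (b ∷ bs) (c ∷ cs) = toℕ c · b + combination bs cs

      combination-+ : ∀ {k} (bs : Vec Carrier k) cs ds →
                      combination bs (cs +Zpm ds) ≡ combination bs cs + combination bs ds
      combination-+ []       []       []       = sym (identityˡ 0#)
      combination-+ (b ∷ bs) (c ∷ cs) (d ∷ ds) = begin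
        toℕ (c +mod d) · b + combination bs (cs +Zpm ds)
          ≡⟨ cong₂ _+_ c+d·b≡c·b+d·b (combination-+ bs cs ds) ⟩
        (toℕ c · b + toℕ d · b) + (combination bs cs + combination bs ds)
          ≡⟨ interchange _ _ _ _ ⟩
        (toℕ c · b + combination bs cs) + (toℕ d · b + combination bs ds) ∎
        where
        open ≡-Reasoning
        open import Algebra.Properties.CommutativeSemigroup
          (CommutativeMonoid.commutativeSemigroup commutativeMonoid) using (interchange)
        c+d·b≡c·b+d·b : toℕ (c +mod d) · b ≡ toℕ c · b + toℕ d · b
        c+d·b≡c·b+d·b = trans (cong (_· b) (Fin.toℕ-fromℕ< (m%n<n (toℕ c ℕ.+ toℕ d) r)))
                          (trans (sym (·-mod-period (r·x≡0 b) (toℕ c ℕ.+ toℕ d)))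
                                 (·-homo-+ b (toℕ c) (toℕ d)))

      Span : ∀ {k} → Vec Carrier k → Carrier → Set
      Span bs y = ∃[ cs ] combination bs cs ≡ y

      Independent : ∀ {k} → Vec Carrier k → Set
      Independent bs = Injective _≡_ _≡_ (combination bs)

      module _ {k} {bs : Vec Carrier k} where
        private module V = Inverse (Vec↔Fin^ (↔-refl {A = Fin r}) k)

        span-0 : Span bs 0#
        span-0 = replicate k Fin.zero , combination-zeros bs
          where
          combination-zeros : ∀ {k} (bs : Vec Carrier k) → combination bs (replicate k Fin.zero) ≡ 0#
          combination-zeros []       = refl
          combination-zeros (b ∷ bs) = trans (identityˡ _) (combination-zeros bs)

        span-+ : ∀ {y z} → Span bs y → Span bs z → Span bs (y + z)
        span-+ (cs , refl) (ds , refl) = cs +Zpm ds , combination-+ bs cs ds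

        span-· : ∀ {y} n → Span bs y → Span bs (n · y)
        span-· zero    _      = span-0
        span-· (suc n) y∈span = span-+ y∈span (span-· n y∈span)

        span-neg : ∀ {y} → Span bs y → Span bs (- y)
        span-neg {y} y∈span = subst (Span bs) s·y≡-y (span-· s y∈span)
          where
          s·y≡-y : s · y ≡ - y
          s·y≡-y = inverseʳ-unique y (s · y) (r·x≡0 y)

        -- d is invertible modulo the prime r, so b is a multiple of d · b.
        span-divide : ∀ {b d} → 0 < d → d < r → Span bs (d · b) → Span bs b
        span-divide {b} {d} d>0 d<r d·b∈span
          with coprime-Bézout (Data.Nat.Coprimality.sym (prime⇒coprime r-prime {{ℕ.>-nonZero d>0}} d<r))
        ... | Bézout.+- x y 1+y*r≡x*d = subst (Span bs) x·d·b≡b (span-· x d·b∈span)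
          where
          x·d·b≡b : x · d · b ≡ b
          x·d·b≡b = begin
            x · d · b            ≡⟨ ·-assocˡ b x d ⟩
            (x * d) · b          ≡⟨ cong (_· b) 1+y*r≡x*d ⟨
            (1 ℕ.+ y * r) · b    ≡⟨ ·-homo-+ b 1 (y * r) ⟩
            1 · b + (y * r) · b  ≡⟨ cong₂ _+_ (·-homo-1 b) (∣⇒·≡ε (r·x≡0 b) (n∣m*n y)) ⟩
            b + 0#               ≡⟨ identityʳ b ⟩
            b                    ∎
            where open ≡-Reasoning
        ... | Bézout.-+ x y 1+x*d≡y*r = subst (Span bs) -x·d·b≡b (span-neg (span-· x d·b∈span))
          where
          b+x·d·b≡0 : b + x · d · b ≡ 0#
          b+x·d·b≡0 = begin
            b + x · d · b        ≡⟨ cong₂ _+_ (sym (·-homo-1 b)) (·-assocˡ b x d) ⟩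
            1 · b + (x * d) · b  ≡⟨ ·-homo-+ b 1 (x * d) ⟨
            (1 ℕ.+ x * d) · b    ≡⟨ cong (_· b) 1+x*d≡y*r ⟩
            (y * r) · b          ≡⟨ ∣⇒·≡ε (r·x≡0 b) (n∣m*n y) ⟩
            0#                   ∎
            where open ≡-Reasoning
          -x·d·b≡b : - (x · d · b) ≡ b
          -x·d·b≡b = trans (cong -_ (inverseʳ-unique b _ b+x·d·b≡0)) (⁻¹-involutive b)

        private
          coefficient-gap⇒span : ∀ {b} {c c′ : Fin r} {cs cs′} → toℕ c < toℕ c′ →
            toℕ c · b + combination bs cs ≡ toℕ c′ · b + combination bs cs′ → Span bs b
          coefficient-gap⇒span {b} {c} {c′} {cs} {cs′} c<c′ eq =
            span-divide (ℕ.m<n⇒0<n∸m c<c′) (ℕ.≤-<-trans (ℕ.m∸n≤m (toℕ c′) (toℕ c)) (Fin.toℕ<n c′))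
              (subst (Span bs) u-u′≡d·b (span-+ (cs , refl) (span-neg (cs′ , refl))))
            where
            open ≡-Reasoning
            d : ℕ
            d = toℕ c′ ∸ toℕ c
            u u′ : Carrier
            u = combination bs cs
            u′ = combination bs cs′
            u≡d·b+u′ : u ≡ d · b + u′
            u≡d·b+u′ = ∙-cancelˡ (toℕ c · b) _ _ (begin
              toℕ c · b + u                   ≡⟨ eq ⟩
              toℕ c′ · b + u′                 ≡⟨ cong (λ t → t · b + u′) (ℕ.m+[n∸m]≡n (ℕ.<⇒≤ c<c′)) ⟨
              (toℕ c ℕ.+ d) · b + u′          ≡⟨ cong (_+ u′) (·-homo-+ b (toℕ c) d) ⟩
              (toℕ c · b + d · b) + u′        ≡⟨ assoc _ _ _ ⟩
              toℕ c · b + (d · b + u′)        ∎)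
            u-u′≡d·b : u + - u′ ≡ d · b
            u-u′≡d·b = begin
              u + - u′                        ≡⟨ cong (_+ - u′) u≡d·b+u′ ⟩
              (d · b + u′) + - u′             ≡⟨ assoc _ _ _ ⟩
              d · b + (u′ + - u′)             ≡⟨ cong (d · b +_) (inverseʳ u′) ⟩
              d · b + 0#                      ≡⟨ identityʳ _ ⟩
              d · b                           ∎

        independent-∷ : ∀ {b} → ¬ Span bs b → Independent bs → Independent (b ∷ bs)
        independent-∷ {b} b∉span independent {c ∷ cs} {c′ ∷ cs′} eq with ℕ.<-cmp (toℕ c) (toℕ c′)
        ... | tri< c<c′ _ _ = contradiction (coefficient-gap⇒span c<c′ eq) b∉span
        ... | tri> _ _ c′<c = contradiction (coefficient-gap⇒span c′<c (sym eq)) b∉span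
        ... | tri≈ _ c≡c′ _ = cong₂ _∷_ (Fin.toℕ-injective c≡c′)
              (independent (∙-cancelˡ _ _ _ (trans eq (cong (λ t → t · b + _) (sym c≡c′)))))

        span? : ∀ y → Dec (Span bs y)
        span? y with Fin.any? (λ j → combination bs (V.from j) ≟ y)
        ... | yes (j , eq) = yes (V.from j , eq)
        ... | no none = no λ { (cs , eq) →
                none (V.to cs , trans (cong (combination bs) (V.strictlyInverseʳ cs)) eq) }

      Basis : Set
      Basis = ∃[ k ] Σ (Vec Carrier k) λ bs → Independent bs × (∀ y → Span bs y)

      private
        -- fuel = card - k bounds the recursion: a family of size card + 1 is never
        -- independent, as it has r ^ (card + 1) > card combinations.
        extend : ∀ fuel {k} (bs : Vec Carrier k) → Independent bs → k ℕ.+ fuel ≡ card → Basis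
        extend fuel {k} bs independent k+fuel≡card with Fin.all? (λ i → span? {bs = bs} (from i))
        ... | yes spanning =
          k , bs , independent , λ y → subst (Span bs) (strictlyInverseʳ y) (spanning (to y))
        ... | no ¬spanning with Fin.¬∀⟶∃¬ card _ (λ i → span? {bs = bs} (from i)) ¬spanning
        ... | i , new with fuel
        ...   | suc fuel′ = extend fuel′ (from i ∷ bs) (independent-∷ {bs = bs} new independent)
                              (trans (sym (ℕ.+-suc k fuel′)) k+fuel≡card)
        ...   | zero = contradiction
          (injective⇒card≤ (Vec↔Fin^ ↔-refl (suc k)) enum _ (independent-∷ {bs = bs} new independent))
          (ℕ.<⇒≱ (subst (_< r ^ suc k) (trans (sym (ℕ.+-identityʳ k)) k+fuel≡card)
                    (ℕ.<-trans (ℕ.n<1+n k) (n<m^n (prime>1 r-prime) (suc k)))))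

      basis : Basis
      basis = extend card [] (λ { {[]} {[]} _ → refl }) refl

      iso-from-Zpm : ∃[ k ] r ^ k ≡ card × IsoFromZpm r k G
      iso-from-Zpm with basis
      ... | k , bs , independent , spanning =
        k , bijection⇒card≡ (Vec↔Fin^ ↔-refl k) enum (combination bs) independent spanning
          , combination bs , independent , spanning , combination-+ bs

    neg-as-multiple : ∀ {x o} → 0 < o → o · x ≡ 0# → - x ≡ (o ∸ 1) · x
    neg-as-multiple {x} {suc o} _ x+o·x≡0 = sym (inverseʳ-unique x (o · x) x+o·x≡0)

    natural-multiples : ∀ {c} → (∀ x → ∃[ n ] x ≡ n ·ℤ c) → ∀ x → ∃[ n ] n · c ≡ x
    natural-multiples {c} cyclic x with cyclic x | order-exists (invertible c)
    ... | ℤ+ n , x≡n·c | _ = n , sym (trans x≡n·c (·ℕ≡· n c))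
    ... | -[1+ n ] , x≡-n·c | o , c-order = (o ∸ 1) * suc n , sym (begin
      x                              ≡⟨ x≡-n·c ⟩
      - (suc n ·ℕ c)                 ≡⟨ cong -_ (·ℕ≡· (suc n) c) ⟩
      - (suc n · c)                  ≡⟨ neg-as-multiple (order>0 c-order) o·n·c≡0 ⟩
      (o ∸ 1) · suc n · c            ≡⟨ ·-assocˡ c (o ∸ 1) (suc n) ⟩
      ((o ∸ 1) * suc n) · c          ∎)
      where
      open ≡-Reasoning
      o·n·c≡0 : o · suc n · c ≡ 0#
      o·n·c≡0 = trans (·-swap c o (suc n)) (trans (cong (suc n ·_) (·-order c-order)) (·-ε (suc n)))

    generator-order : ∀ {c o} → (∀ x → ∃[ n ] n · c ≡ x) → c HasOrder o → o ≡ card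
    generator-order {c} {o} generates c-order =
      bijection⇒card≡ ↔-refl enum multiple multiple-injective multiple-surjective
      where
      instance
        o≢0 : ℕ.NonZero o
        o≢0 = ℕ.>-nonZero (order>0 c-order)
      multiple : Fin o → Carrier
      multiple i = toℕ i · c
      multiple-injective : Injective _≡_ _≡_ multiple
      multiple-injective eq =
        Fin.toℕ-injective (·-injective-below-order c-order (invertible c) (Fin.toℕ<n _) (Fin.toℕ<n _) eq)
      multiple-surjective : StrictlySurjective _≡_ multiple
      multiple-surjective x with generates x
      ... | n , n·c≡x = Fin.fromℕ< (m%n<n n o) ,
        trans (cong (_· c) (Fin.toℕ-fromℕ< (m%n<n n o))) (trans (sym (·-mod-order c-order n)) n·c≡x)

    elementary-abelian : ∀ {r} → Prime r → (∀ x → r · x ≡ 0#) → ∃[ k ] r ^ k ≡ card × IsoFromZpm r k G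
    elementary-abelian {zero}  r-prime _     = contradiction (prime>1 r-prime) λ ()
    elementary-abelian {suc s} r-prime r·x≡0 = ElementaryAbelian.iso-from-Zpm r-prime r·x≡0


module FieldIsomorphisms where

  open import Data.Nat as ℕ using (ℕ; zero; suc; _≤_; _<_; _^_; s≤s; z≤n)
  import Data.Nat.Properties as ℕ
  open import Data.Nat.Divisibility using (_∣_; divides; ∣-antisym; m∣m*n; n∣m*n)
  open import Data.Nat.Primality using (Prime; Irreducible; irreducible⇒prime)
  open import Data.Integer using () renaming (+_ to ℤ+_)
  open import Data.Product using (∃-syntax; _×_; _,_; proj₁; proj₂)
  open import Data.Sum using (inj₁; inj₂)
  open import Relation.Nullary using (contradiction)
  open import Relation.Binary.PropositionalEquality
  open import Function using (_∘_)
  open import Function.Properties.Inverse using (↔-refl)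
  open Counting
  open PrimePowers
  open Orders
  open Groups

  additiveGroup : FinField → FinAbGroup
  additiveGroup F = record
    { Carrier = Carrier ; _+_ = _+_ ; 0# = 0# ; -_ = -_
    ; isAbelianGroup = IsCommutativeRing.+-isAbelianGroup isCommutativeRing
    ; card = card ; enum = enum }
    where
    open FinField F
    open import Algebra.Structures using (IsCommutativeRing)

  module Characteristic (F : FinField) where
    open FieldFacts F
    open GroupFacts (additiveGroup F) using (_·_; _HasOrder_; order-exists; invertible; order-∣)
    open _HasOrder_
    open import Algebra.Properties.Semiring.Mult semiring using (×1-homo-*; ×-assoc-*)

    characteristic : ℕ
    characteristic = proj₁ (order-exists (invertible 1#))

    1#-order : 1# HasOrder characteristic
    1#-order = proj₂ (order-exists (invertible 1#))

    ·-characteristic : ∀ x → characteristic · x ≡ 0#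
    ·-characteristic x = begin
      characteristic · x              ≡⟨ cong (characteristic ·_) (*-identityˡ x) ⟨
      characteristic · (1# * x)       ≡⟨ ×-assoc-* characteristic 1# x ⟨
      (characteristic · 1#) * x       ≡⟨ cong (_* x) (·-order 1#-order) ⟩
      0# * x                          ≡⟨ zeroˡ x ⟩
      0#                              ∎
      where open ≡-Reasoning

    -- r = d′ * d gives (d′ · 1) * (d · 1) = 0, so r divides d or d′.
    characteristic-prime : Prime characteristic
    characteristic-prime = irreducible⇒prime {{ℕ.n>1⇒nonTrivial 1<r}} irreducible
      where
      r : ℕ
      r = characteristic
      1<r : 1 < r
      1<r with r | order>0 1#-order | ·-order 1#-order
      ... | suc zero    | _ | 1+0≡0 = contradiction (trans (sym (+-identityʳ 1#)) 1+0≡0) 1≢0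
      ... | suc (suc _) | _ | _     = s≤s (s≤s z≤n)
      irreducible : Irreducible r
      irreducible {d} d∣r@(divides d′ r≡d′*d) with *-≡0 d′·1*d·1≡0
        where
        d′·1*d·1≡0 : (d′ · 1#) * (d · 1#) ≡ 0#
        d′·1*d·1≡0 = trans (sym (×1-homo-* d′ d)) (trans (cong (_· 1#) (sym r≡d′*d)) (·-order 1#-order))
      ... | inj₂ d·1≡0 = inj₂ (∣-antisym d∣r (order-∣ 1#-order d·1≡0))
      ... | inj₁ d′·1≡0 = inj₁ (ℕ.*-cancelˡ-≡ d 1 r {{ℕ.>-nonZero (order>0 1#-order)}} r*d≡r*1)
        where
        d′≡r : d′ ≡ r
        d′≡r = ∣-antisym (subst (d′ ∣_) (trans (ℕ.*-comm d d′) (sym r≡d′*d)) (n∣m*n d))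
                         (order-∣ 1#-order d′·1≡0)
        r*d≡r*1 : r ℕ.* d ≡ r ℕ.* 1
        r*d≡r*1 = trans (cong (ℕ._* d) (sym d′≡r)) (trans (sym r≡d′*d) (sym (ℕ.*-identityʳ r)))

  module Coordinates (F : FinField) {p m} (p-prime : Prime p) (1≤m : 1 ≤ m)
                     (card≡p^m : FinField.card F ≡ p ^ m) where
    open Characteristic F
    open GroupFacts (additiveGroup F) using (elementary-abelian)

    Zpm≅F⁺ : IsoFromZpm p m (additiveGroup F)
    Zpm≅F⁺ with elementary-abelian characteristic-prime ·-characteristic
    ... | k , r^k≡card , iso = subst₂ (λ r k → IsoFromZpm r k (additiveGroup F)) r≡p k≡m iso
      where
      r^k≡p^m : characteristic ^ k ≡ p ^ m
      r^k≡p^m = trans r^k≡card card≡p^m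
      r≡p : characteristic ≡ p
      r≡p = sym (prime∣prime^⇒≡ k p-prime characteristic-prime
                   (subst (p ∣_) (sym r^k≡p^m) (p∣p^m m 1≤m)))
        where
        p∣p^m : ∀ m → 1 ≤ m → p ∣ p ^ m
        p∣p^m (suc m) _ = m∣m*n (p ^ m)
      k≡m : k ≡ m
      k≡m = ^-injectiveʳ (prime>1 p-prime) (subst (λ r → r ^ k ≡ p ^ m) r≡p r^k≡p^m)

  module Homomorphisms (F : FinField) (G : FinAbGroup) where
    open FieldFacts F
    private
      module G = GroupFacts G
      module U = Units F

    module Additive {ψ : ⟨ G ⟩ → Carrier} (ψ-+ : ∀ x y → ψ (x G.+ y) ≡ ψ x + ψ y) where

      ψ-0 : ψ G.0# ≡ 0#
      ψ-0 = +-cancelˡ (ψ G.0#) _ _ (trans (sym (ψ-+ G.0# G.0#))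
              (trans (cong ψ (G.identityʳ G.0#)) (sym (+-identityʳ _))))

      ψ-neg : ∀ x → ψ (G.- x) ≡ - ψ x
      ψ-neg x = inverseʳ-unique (ψ x) _ (trans (sym (ψ-+ x (G.- x))) (trans (cong ψ (G.inverseʳ x)) ψ-0))

      ψ-sub : ∀ x y → ψ (x G.- y) ≡ ψ x - ψ y
      ψ-sub x y = trans (ψ-+ x (G.- y)) (cong (ψ x +_) (ψ-neg y))

    module Multiplicative {ψ : ⟨ G ⟩ → Carrier} (ψ≢0 : ∀ x → ψ x ≢ 0#)
                          (ψ-+ : ∀ x y → ψ (x G.+ y) ≡ ψ x * ψ y) where

      ψ-0 : ψ G.0# ≡ 1#
      ψ-0 = *-cancelˡ (ψ≢0 G.0#) (trans (sym (ψ-+ G.0# G.0#))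
              (trans (cong ψ (G.identityʳ G.0#)) (sym (*-identityʳ _))))

      ψ-· : ∀ n x → ψ (n G.· x) ≡ n U.· ψ x
      ψ-· zero    x = ψ-0
      ψ-· (suc n) x = trans (ψ-+ x (n G.· x)) (cong (ψ x *_) (ψ-· n x))

    IsoToZpm⇒card : ∀ {p m} → IsoToZpm p m G → G.card ≡ p ^ m
    IsoToZpm⇒card {m = m} (ψ , ψ-bij , _) = bijection⇒card≡ G.enum (Vec↔Fin^ ↔-refl m) ψ
      (λ {x} {y} → proj₁ ψ-bij x y) (proj₂ ψ-bij)

    addIso-via-Zpm : ∀ {p m} → IsoToZpm p m G → IsoFromZpm p m (additiveGroup F) → ∃[ ψ₂ ] IsAddIso G F ψ₂
    addIso-via-Zpm (ψ , (ψ-injective , ψ-surjective) , ψ-+) (L , L-injective , L-surjective , L-+) =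
      (L ∘ ψ) , ((λ x y → ψ-injective x y ∘ L-injective) , surjective) ,
      λ x y → trans (cong L (ψ-+ x y)) (L-+ (ψ x) (ψ y))
      where
      surjective : Surj (L ∘ ψ)
      surjective y with L-surjective y
      ... | u , Lu≡y with ψ-surjective u
      ... | x , ψx≡u = x , trans (cong L ψx≡u) Lu≡y

    module _ (P : U.PrimitiveElement) where
      open U.PrimitiveElement P

      cyclic⇒mulIso : Cyclic G → G.card ≡ order → ∃[ ψ₁ ] IsMulIso G F ψ₁
      cyclic⇒mulIso (c , cyclic) card≡order with G.order-exists (G.invertible c)
      ... | o , c-order′ = ψ₁ , injective , nonzero , onto , homomorphic
        where
        multiples : ∀ x → ∃[ n ] n G.· c ≡ x
        multiples = G.natural-multiples cyclic
        c-order : c G.HasOrder order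
        c-order = subst (c G.HasOrder_) (trans (G.generator-order multiples c-order′) card≡order) c-order′
        index : ⟨ G ⟩ → ℕ
        index x = proj₁ (multiples x)
        index-spec : ∀ x → index x G.· c ≡ x
        index-spec x = proj₂ (multiples x)
        ψ₁ : ⟨ G ⟩ → Carrier
        ψ₁ x = index x U.· g
        G⇒F : ∀ i j → i G.· c ≡ j G.· c → i U.· g ≡ j U.· g
        G⇒F i j eq = U.%≡%⇒·≡· g-order {i} {j} (G.·≡·⇒%≡% c-order (G.invertible c) {i} {j} eq)
        F⇒G : ∀ i j → i U.· g ≡ j U.· g → i G.· c ≡ j G.· c
        F⇒G i j eq = G.%≡%⇒·≡· c-order {i} {j} (U.·≡·⇒%≡% g-order g-invertible {i} {j} eq)
        injective : Inj ψ₁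
        injective x y eq = trans (sym (index-spec x)) (trans (F⇒G (index x) (index y) eq) (index-spec y))
        nonzero : ∀ x → ψ₁ x ≢ 0#
        nonzero x = U.invertible⇒nonzero (U.invertible-· (index x) g-invertible)
        onto : ∀ y → y ≢ 0# → ∃[ x ] ψ₁ x ≡ y
        onto y y≢0 with generates y≢0
        ... | i , i·g≡y = i G.· c , trans (G⇒F (index (i G.· c)) i (index-spec (i G.· c))) i·g≡y
        homomorphic : ∀ x y → ψ₁ (x G.+ y) ≡ ψ₁ x * ψ₁ y
        homomorphic x y = trans (G⇒F (index (x G.+ y)) (index x ℕ.+ index y) (begin
            index (x G.+ y) G.· c                      ≡⟨ index-spec (x G.+ y) ⟩
            x G.+ y                                    ≡⟨ cong₂ G._+_ (index-spec x) (index-spec y) ⟨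
            (index x G.· c) G.+ (index y G.· c)        ≡⟨ G.·-homo-+ c (index x) (index y) ⟨
            (index x ℕ.+ index y) G.· c                ∎))
          (U.·-homo-+ g (index x) (index y))
          where open ≡-Reasoning

      mulIso⇒cyclic : ∀ {ψ₁} → IsMulIso G F ψ₁ → Cyclic G
      mulIso⇒cyclic {ψ₁} (ψ₁-injective , ψ₁≢0 , ψ₁-onto , ψ₁-+) = c , generated
        where
        open Multiplicative ψ₁≢0 ψ₁-+
        c : ⟨ G ⟩
        c = proj₁ (ψ₁-onto g (U.invertible⇒nonzero g-invertible))
        ψ₁c≡g : ψ₁ c ≡ g
        ψ₁c≡g = proj₂ (ψ₁-onto g (U.invertible⇒nonzero g-invertible))
        generated : ∀ x → ∃[ n ] x ≡ n G.·ℤ c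
        generated x = ℤ+ n , trans (ψ₁-injective x (n G.· c)
            (trans (sym n·g≡ψ₁x) (trans (cong (n U.·_) (sym ψ₁c≡g)) (sym (ψ-· n c)))))
            (sym (G.·ℕ≡· n c))
          where
          n : ℕ
          n = proj₁ (generates (ψ₁≢0 x))
          n·g≡ψ₁x : n U.· g ≡ ψ₁ x
          n·g≡ψ₁x = proj₂ (generates (ψ₁≢0 x))


module CostasTransport where

  import Data.Nat as ℕ
  open import Data.Product using (∃-syntax; _×_; _,_; proj₁; proj₂)
  open import Function using (_∘_)
  open import Relation.Nullary using (yes; no; contradiction)
  open import Relation.Binary.PropositionalEquality
  open Counting
  open Groups
  open FieldIsomorphisms

  IsCostasFunction : (F : FinField) → (FinField.Carrier F → FinField.Carrier F) → Set
  IsCostasFunction F h = (h 0# ≡ 0#) × (∀ d → d ≢ 1# → Bij (λ x → h (d * x) - h x))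
    where open FinField F

  Bij-cong : ∀ {A B : Set} {f g : A → B} → (∀ x → f x ≡ g x) → Bij f → Bij g
  Bij-cong f≗g (f-injective , f-surjective) =
    (λ x y gx≡gy → f-injective x y (trans (f≗g x) (trans gx≡gy (sym (f≗g y))))) ,
    (λ y → proj₁ (f-surjective y) , trans (sym (f≗g _)) (proj₂ (f-surjective y)))

  costas-cong : ∀ (F : FinField) {h h′} → (∀ t → h t ≡ h′ t) → IsCostasFunction F h → IsCostasFunction F h′
  costas-cong F {h} {h′} h≗h′ (h0≡0 , scaling-bijective) =
    trans (sym (h≗h′ 0#)) h0≡0 ,
    λ d d≢1 → Bij-cong (λ t → cong₂ _-_ (h≗h′ (d * t)) (h≗h′ t)) (scaling-bijective d d≢1)
    where open FinField F


  module Transport (F : FinField) (G₁ G₂ : FinAbGroup)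
                   {ψ₁ : ⟨ G₁ ⟩ → FinField.Carrier F} (ψ₁-iso : IsMulIso G₁ F ψ₁)
                   {ψ₂ : ⟨ G₂ ⟩ → FinField.Carrier F} (ψ₂-iso : IsAddIso G₂ F ψ₂) where
    open FieldFacts F
    private
      module G₁ = GroupFacts G₁
      module G₂ = GroupFacts G₂

      ψ₁-injective : Inj ψ₁
      ψ₁-injective = proj₁ ψ₁-iso
      ψ₁≢0 : ∀ x → ψ₁ x ≢ 0#
      ψ₁≢0 = proj₁ (proj₂ ψ₁-iso)
      ψ₁-onto : ∀ y → y ≢ 0# → ∃[ x ] ψ₁ x ≡ y
      ψ₁-onto = proj₁ (proj₂ (proj₂ ψ₁-iso))
      ψ₁-+ : ∀ x y → ψ₁ (x G₁.+ y) ≡ ψ₁ x * ψ₁ y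
      ψ₁-+ = proj₂ (proj₂ (proj₂ ψ₁-iso))
      ψ₂-injective : Inj ψ₂
      ψ₂-injective = proj₁ (proj₁ ψ₂-iso)
      ψ₂-surjective : Surj ψ₂
      ψ₂-surjective = proj₂ (proj₁ ψ₂-iso)
      ψ₂-+ : ∀ x y → ψ₂ (x G₂.+ y) ≡ ψ₂ x + ψ₂ y
      ψ₂-+ = proj₂ ψ₂-iso

    open Homomorphisms.Multiplicative F G₁ ψ₁≢0 ψ₁-+ using () renaming (ψ-0 to ψ₁-0)
    open Homomorphisms.Additive F G₂ ψ₂-+ using () renaming (ψ-0 to ψ₂-0; ψ-neg to ψ₂-neg; ψ-sub to ψ₂-sub)

    ψ₂≢0 : ∀ {y} → y ≢ G₂.0# → ψ₂ y ≢ 0#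
    ψ₂≢0 y≢0 ψ₂y≡0 = y≢0 (ψ₂-injective _ _ (trans ψ₂y≡0 (sym ψ₂-0)))

    transport : (⟨ G₁ ⟩ → ⟨ G₂ ⟩) → Carrier → Carrier
    transport φ t with t ≟ 0#
    ... | yes _   = 0#
    ... | no t≢0  = ψ₂ (φ (proj₁ (ψ₁-onto t t≢0)))

    module _ (φ : ⟨ G₁ ⟩ → ⟨ G₂ ⟩) where

      transport-0 : transport φ 0# ≡ 0#
      transport-0 with 0# ≟ 0#
      ... | yes _   = refl
      ... | no 0≢0  = contradiction refl 0≢0

      transport-ψ₁ : ∀ x → transport φ (ψ₁ x) ≡ ψ₂ (φ x)
      transport-ψ₁ x with ψ₁ x ≟ 0#
      ... | yes ψ₁x≡0 = contradiction ψ₁x≡0 (ψ₁≢0 x)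
      ... | no ψ₁x≢0  = cong (ψ₂ ∘ φ) (ψ₁-injective _ _ (proj₂ (ψ₁-onto (ψ₁ x) ψ₁x≢0)))

      transport-unique : ∀ {h} → h 0# ≡ 0# → (∀ x → h (ψ₁ x) ≡ ψ₂ (φ x)) → ∀ t → transport φ t ≡ h t
      transport-unique {h} h0≡0 hψ₁≡ψ₂φ t with t ≟ 0#
      ... | yes refl = sym h0≡0
      ... | no t≢0   = trans (sym (hψ₁≡ψ₂φ _)) (cong h (proj₂ (ψ₁-onto t t≢0)))

    private
      at-preimage : ∀ (D : Carrier → Carrier) (Γ : ⟨ G₁ ⟩ → ⟨ G₂ ⟩) → (∀ i → D (ψ₁ i) ≡ ψ₂ (Γ i)) →
                    ∀ t (t≢0 : t ≢ 0#) → D t ≡ ψ₂ (Γ (proj₁ (ψ₁-onto t t≢0)))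
      at-preimage D Γ Dψ₁≡ψ₂Γ t t≢0 = trans (cong D (sym (proj₂ (ψ₁-onto t t≢0)))) (Dψ₁≡ψ₂Γ _)

    conjugate-injective : ∀ (D : Carrier → Carrier) (Γ : ⟨ G₁ ⟩ → ⟨ G₂ ⟩) → D 0# ≡ 0# →
                          (∀ i → D (ψ₁ i) ≡ ψ₂ (Γ i)) → (∀ i → Γ i ≢ G₂.0#) → Inj Γ → Inj D
    conjugate-injective D Γ D0≡0 Dψ₁≡ψ₂Γ Γ≢0 Γ-injective t t′ eq with t ≟ 0# | t′ ≟ 0#
    ... | yes refl | yes refl = refl
    ... | yes refl | no t′≢0 =
      contradiction (trans (sym (at-preimage D Γ Dψ₁≡ψ₂Γ t′ t′≢0)) (trans (sym eq) D0≡0)) (ψ₂≢0 (Γ≢0 _))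
    ... | no t≢0   | yes refl =
      contradiction (trans (sym (at-preimage D Γ Dψ₁≡ψ₂Γ t t≢0)) (trans eq D0≡0)) (ψ₂≢0 (Γ≢0 _))
    ... | no t≢0   | no t′≢0 =
      trans (sym (proj₂ (ψ₁-onto t t≢0))) (trans (cong ψ₁ (Γ-injective _ _ (ψ₂-injective _ _
        (trans (sym (at-preimage D Γ Dψ₁≡ψ₂Γ t t≢0)) (trans eq (at-preimage D Γ Dψ₁≡ψ₂Γ t′ t′≢0))))))
        (proj₂ (ψ₁-onto t′ t′≢0)))

    module _ {φ : ⟨ G₁ ⟩ → ⟨ G₂ ⟩} (φ-costas : IsStandardCircularCostas G₁ G₂ φ) where
      private
        φ-injective : Inj φ
        φ-injective = proj₁ (proj₂ (proj₁ φ-costas))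
        shift-injective : ∀ k → k ≢ G₁.0# → Inj (λ i → φ (i G₁.+ k) G₂.- φ i)
        shift-injective = proj₂ (proj₂ (proj₁ φ-costas))
        φ-standard : IsStandard G₁ G₂ φ
        φ-standard = proj₂ φ-costas

        h : Carrier → Carrier
        h = transport φ

        φ≢0 : ∀ x → φ x ≢ G₂.0#
        φ≢0 x = proj₂ (φ-standard (φ x)) (x , refl)

        h0-h0≡0 : ∀ {d} → h (d * 0#) - h 0# ≡ 0#
        h0-h0≡0 {d} = trans (cong (λ t → h t - h 0#) (zeroʳ d)) (-‿inverseʳ _)

        scaling-by-0-injective : Inj (λ t → h (0# * t) - h t)
        scaling-by-0-injective = conjugate-injective _ (G₂.-_ ∘ φ) h0-h0≡0 conj negφ≢0
          (λ i j → φ-injective i j ∘ G₂.⁻¹-injective)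
          where
          conj : ∀ i → h (0# * ψ₁ i) - h (ψ₁ i) ≡ ψ₂ (G₂.- φ i)
          conj i = begin
            h (0# * ψ₁ i) - h (ψ₁ i)   ≡⟨ cong₂ _-_ (trans (cong h (zeroˡ _)) (transport-0 φ))
                                                    (transport-ψ₁ φ i) ⟩
            0# - ψ₂ (φ i)              ≡⟨ +-identityˡ _ ⟩
            - ψ₂ (φ i)                 ≡⟨ ψ₂-neg (φ i) ⟨
            ψ₂ (G₂.- φ i)              ∎
            where open ≡-Reasoning
          negφ≢0 : ∀ i → G₂.- φ i ≢ G₂.0#
          negφ≢0 i negφi≡0 = φ≢0 i (trans (sym (G₂.⁻¹-involutive (φ i))) (trans (cong G₂.-_ negφi≡0) G₂.ε⁻¹≈ε))

        scaling-by-unit-injective : ∀ k → ψ₁ k ≢ 1# → Inj (λ t → h (ψ₁ k * t) - h t)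
        scaling-by-unit-injective k ψ₁k≢1 =
          conjugate-injective _ (λ i → φ (i G₁.+ k) G₂.- φ i) h0-h0≡0 conj shift≢0 (shift-injective k k≢0)
          where
          k≢0 : k ≢ G₁.0#
          k≢0 refl = ψ₁k≢1 ψ₁-0
          conj : ∀ i → h (ψ₁ k * ψ₁ i) - h (ψ₁ i) ≡ ψ₂ (φ (i G₁.+ k) G₂.- φ i)
          conj i = begin
            h (ψ₁ k * ψ₁ i) - h (ψ₁ i)         ≡⟨ cong (λ t → h t - h (ψ₁ i))
                                                     (trans (*-comm _ _) (sym (ψ₁-+ i k))) ⟩
            h (ψ₁ (i G₁.+ k)) - h (ψ₁ i)       ≡⟨ cong₂ _-_ (transport-ψ₁ φ (i G₁.+ k)) (transport-ψ₁ φ i) ⟩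
            ψ₂ (φ (i G₁.+ k)) - ψ₂ (φ i)       ≡⟨ ψ₂-sub (φ (i G₁.+ k)) (φ i) ⟨
            ψ₂ (φ (i G₁.+ k) G₂.- φ i)         ∎
            where open ≡-Reasoning
          shift≢0 : ∀ i → φ (i G₁.+ k) G₂.- φ i ≢ G₂.0#
          shift≢0 i eq = k≢0 (G₁.identityʳ-unique i k (φ-injective _ _ (G₂.x∙y⁻¹≈ε⇒x≈y _ _ eq)))

      transport-costas : IsCostasFunction F (transport φ)
      transport-costas = transport-0 φ , λ d d≢1 → injective⇒bijective (scaling-injective d d≢1)
        where
        scaling-injective : ∀ d → d ≢ 1# → Inj (λ t → h (d * t) - h t)
        scaling-injective d d≢1 with d ≟ 0#
        ... | yes refl = scaling-by-0-injective
        ... | no d≢0   = subst (λ d → Inj (λ t → h (d * t) - h t)) ψ₁k≡d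
                           (scaling-by-unit-injective k (d≢1 ∘ trans (sym ψ₁k≡d)))
          where
          k : ⟨ G₁ ⟩
          k = proj₁ (ψ₁-onto d d≢0)
          ψ₁k≡d : ψ₁ k ≡ d
          ψ₁k≡d = proj₂ (ψ₁-onto d d≢0)

    ψ₂⁻¹ : Carrier → ⟨ G₂ ⟩
    ψ₂⁻¹ t = proj₁ (ψ₂-surjective t)

    untransport : (Carrier → Carrier) → ⟨ G₁ ⟩ → ⟨ G₂ ⟩
    untransport h x = ψ₂⁻¹ (h (ψ₁ x))

    ψ₂-untransport : ∀ h x → ψ₂ (untransport h x) ≡ h (ψ₁ x)
    ψ₂-untransport h x = proj₂ (ψ₂-surjective (h (ψ₁ x)))

    module _ {h : Carrier → Carrier} (h-costas : IsCostasFunction F h) where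
      private
        h0≡0 : h 0# ≡ 0#
        h0≡0 = proj₁ h-costas
        scaling-bijective : ∀ d → d ≢ 1# → Bij (λ x → h (d * x) - h x)
        scaling-bijective = proj₂ h-costas

        -- For d = 0 the Costas condition says that t ↦ - h t is a bijection.
        h-injective : Inj h
        h-injective t t′ eq = proj₁ (scaling-bijective 0# 0≢1) t t′
          (cong₂ _-_ (cong h (trans (zeroˡ t) (sym (zeroˡ t′)))) eq)

        h-surjective : Surj h
        h-surjective y with proj₂ (scaling-bijective 0# 0≢1) (- y)
        ... | t , h0t-ht≡-y = t , ⁻¹-injective (trans (sym (+-identityˡ _))
              (trans (cong (_- h t) (sym (trans (cong h (zeroˡ t)) h0≡0))) h0t-ht≡-y))

        φ : ⟨ G₁ ⟩ → ⟨ G₂ ⟩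
        φ = untransport h

        φ-injective : Inj φ
        φ-injective x x′ eq = ψ₁-injective x x′ (h-injective _ _
          (trans (sym (ψ₂-untransport h x)) (trans (cong ψ₂ eq) (ψ₂-untransport h x′))))

        shift-injective : ∀ k → k ≢ G₁.0# → Inj (λ i → φ (i G₁.+ k) G₂.- φ i)
        shift-injective k k≢0 i i′ eq = ψ₁-injective i i′ (proj₁ (scaling-bijective (ψ₁ k) ψ₁k≢1) _ _
          (trans (sym (difference i)) (trans (cong ψ₂ eq) (difference i′))))
          where
          ψ₁k≢1 : ψ₁ k ≢ 1#
          ψ₁k≢1 ψ₁k≡1 = k≢0 (ψ₁-injective k G₁.0# (trans ψ₁k≡1 (sym ψ₁-0)))
          difference : ∀ i → ψ₂ (φ (i G₁.+ k) G₂.- φ i) ≡ h (ψ₁ k * ψ₁ i) - h (ψ₁ i)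
          difference i = trans (ψ₂-sub _ _) (cong₂ _-_
            (trans (ψ₂-untransport h (i G₁.+ k)) (cong h (trans (ψ₁-+ i k) (*-comm _ _))))
            (ψ₂-untransport h i))

        φ-standard : IsStandard G₁ G₂ φ
        φ-standard y = onto , (λ { (x , refl) → nonzero x })
          where
          nonzero : ∀ x → φ x ≢ G₂.0#
          nonzero x φx≡0 = ψ₁≢0 x (h-injective _ _
            (trans (sym (ψ₂-untransport h x)) (trans (cong ψ₂ φx≡0) (trans ψ₂-0 (sym h0≡0)))))
          onto : y ≢ G₂.0# → ∃[ x ] φ x ≡ y
          onto y≢0 with h-surjective (ψ₂ y)
          ... | t , ht≡ψ₂y with t ≟ 0#
          ...   | yes refl = contradiction (trans (sym ht≡ψ₂y) h0≡0) (ψ₂≢0 y≢0)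
          ...   | no t≢0   = proj₁ (ψ₁-onto t t≢0) , ψ₂-injective _ _
                    (trans (ψ₂-untransport h _) (trans (cong h (proj₂ (ψ₁-onto t t≢0))) ht≡ψ₂y))

      untransport-costas : G₁.card ℕ.+ 1 ≡ G₂.card → IsStandardCircularCostas G₁ G₂ (untransport h)
      untransport-costas card≡ = (card≡ , φ-injective , shift-injective) , φ-standard


module CostasPolynomials (F : FinField) {p m : ℕ} (p-prime : Prime p) (1≤m : 1 ≤ m)
                         (card≡p^m : FinField.card F ≡ p ^ m) where
  open import Data.Nat as ℕ using (suc)
  import Data.Nat.Properties as ℕ
  open import Data.Vec using (Vec; toList)
  open import Data.Product using (Σ; ∃; _,_; proj₁; proj₂)
  open import Function using (_∘_)
  open import Relation.Binary.PropositionalEquality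
  open Groups
  open FieldIsomorphisms
  open CostasTransport
  open FieldFacts F

  P : Units.PrimitiveElement F
  P = Units.primitive-element F

  open Units.PrimitiveElement P using (order; card≡1+order)

  p^m≡1+order : p ^ m ≡ suc order
  p^m≡1+order = trans (sym card≡p^m) card≡1+order

  module _ (G₁ G₂ : FinAbGroup) (cyclic : Cyclic G₁) (card₁≡order : FinAbGroup.card G₁ ≡ order)
           (zpm : IsoToZpm p m G₂) where
    private
      ψ₁-iso : ∃ (IsMulIso G₁ F)
      ψ₁-iso = Homomorphisms.cyclic⇒mulIso F G₁ P cyclic card₁≡order
      ψ₂-iso : ∃ (IsAddIso G₂ F)
      ψ₂-iso = Homomorphisms.addIso-via-Zpm F G₂ zpm (Coordinates.Zpm≅F⁺ F p-prime 1≤m card≡p^m)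
      ψ₁ : ⟨ G₁ ⟩ → Carrier
      ψ₁ = proj₁ ψ₁-iso
      ψ₂ : ⟨ G₂ ⟩ → Carrier
      ψ₂ = proj₁ ψ₂-iso
      ψ₂-injective : Inj ψ₂
      ψ₂-injective = proj₁ (proj₁ (proj₂ ψ₂-iso))
    open Transport F G₁ G₂ (proj₂ ψ₁-iso) (proj₂ ψ₂-iso)

    costas-polynomial : (φ : ⟨ G₁ ⟩ → ⟨ G₂ ⟩) → IsStandardCircularCostas G₁ G₂ φ →
                        Σ (Vec Carrier card) (IsCostasPoly ∘ toList)
    costas-polynomial φ φ-costas = interpolate (transport φ) ,
      costas-cong F (λ t → sym (eval-interpolate (transport φ) t)) (transport-costas φ-costas)

    equivalent-to-costas-polynomial : (φ : ⟨ G₁ ⟩ → ⟨ G₂ ⟩) → IsStandardCircularCostas G₁ G₂ φ →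
                                      EquivToCostasPoly G₁ G₂ F φ
    equivalent-to-costas-polynomial φ φ-costas =
      toList f , proj₂ (costas-polynomial φ φ-costas) , ψ₁ , ψ₂ , proj₂ ψ₁-iso , proj₂ ψ₂-iso ,
      λ x y → (λ φx≡y → trans (f[ψ₁x]≡ψ₂[φx] x) (cong ψ₂ φx≡y)) ,
              (λ f[ψ₁x]≡ψ₂y → ψ₂-injective _ _ (trans (sym (f[ψ₁x]≡ψ₂[φx] x)) f[ψ₁x]≡ψ₂y))
      where
      f : Vec Carrier card
      f = proj₁ (costas-polynomial φ φ-costas)
      f[ψ₁x]≡ψ₂[φx] : ∀ x → eval (toList f) (ψ₁ x) ≡ ψ₂ (φ x)
      f[ψ₁x]≡ψ₂[φx] x = trans (eval-interpolate (transport φ) (ψ₁ x)) (transport-ψ₁ φ x)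

    interpolate-transport-cong : ∀ {φ φ′ : ⟨ G₁ ⟩ → ⟨ G₂ ⟩} → (∀ x → φ x ≡ φ′ x) →
                                 interpolate (transport φ) ≡ interpolate (transport φ′)
    interpolate-transport-cong {φ} {φ′} φ≗φ′ = eval-injective _ _ λ t → begin
      eval (toList (interpolate (transport φ))) t     ≡⟨ eval-interpolate (transport φ) t ⟩
      transport φ t                                   ≡⟨ transport-unique φ (transport-0 φ′) agrees t ⟩
      transport φ′ t                                  ≡⟨ eval-interpolate (transport φ′) t ⟨
      eval (toList (interpolate (transport φ′))) t    ∎
      where
      open ≡-Reasoning
      agrees : ∀ x → transport φ′ (ψ₁ x) ≡ ψ₂ (φ x)
      agrees x = trans (transport-ψ₁ φ′ x) (cong ψ₂ (sym (φ≗φ′ x)))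

    correspondence : FinAbGroup.card G₁ ℕ.+ 1 ≡ FinAbGroup.card G₂ →
                     Bijection (StdCostasMaps G₁ G₂) (CostasPolysDeg< F card)
    correspondence card₁+1≡card₂ = record
      { to        = λ (φ , φ-costas) → costas-polynomial φ φ-costas
      ; cong      = interpolate-transport-cong
      ; bijective = (λ {a} {b} → injective {a} {b}) , surjective
      }
      where
      injective : ∀ {(φ , _) (φ′ , _) : Σ _ (IsStandardCircularCostas G₁ G₂)} →
                  interpolate (transport φ) ≡ interpolate (transport φ′) → ∀ x → φ x ≡ φ′ x
      injective {φ , _} {φ′ , _} same-polynomial x = ψ₂-injective _ _ (begin
        ψ₂ (φ x)                                           ≡⟨ transport-ψ₁ φ x ⟨
        transport φ (ψ₁ x)                                 ≡⟨ eval-interpolate (transport φ) (ψ₁ x) ⟨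
        eval (toList (interpolate (transport φ))) (ψ₁ x)   ≡⟨ cong (λ v → eval (toList v) (ψ₁ x))
                                                                   same-polynomial ⟩
        eval (toList (interpolate (transport φ′))) (ψ₁ x)  ≡⟨ eval-interpolate (transport φ′) (ψ₁ x) ⟩
        transport φ′ (ψ₁ x)                                ≡⟨ transport-ψ₁ φ′ x ⟩
        ψ₂ (φ′ x)                                          ∎)
        where open ≡-Reasoning
      surjective : ∀ ((v , v-costas) : Σ (Vec Carrier card) (IsCostasPoly ∘ toList)) →
                   ∃ λ ((φ , _) : Σ _ (IsStandardCircularCostas G₁ G₂)) →
                     ∀ {(φ′ , _) : Σ _ (IsStandardCircularCostas G₁ G₂)} →
                     (∀ x → φ′ x ≡ φ x) → interpolate (transport φ′) ≡ v
      surjective (v , v-costas) =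
        (untransport (eval (toList v)) , untransport-costas v-costas card₁+1≡card₂) ,
        λ {(φ′ , _)} φ′≗φ → eval-injective _ _ λ t →
          trans (eval-interpolate (transport φ′) t)
            (transport-unique φ′ (proj₁ v-costas)
              (λ x → sym (trans (cong ψ₂ (φ′≗φ x)) (ψ₂-untransport (eval (toList v)) x))) t)

  equivalence : (G₁ G₂ : FinAbGroup) (φ : ⟨ G₁ ⟩ → ⟨ G₂ ⟩) → IsStandardCircularCostas G₁ G₂ φ →
                IsoToZpm p m G₂ → EquivToCostasPoly G₁ G₂ F φ ⇔′ Cyclic G₁
  equivalence G₁ G₂ φ φ-costas zpm =
    (λ (_ , _ , _ , _ , ψ₁-iso , _) → Homomorphisms.mulIso⇒cyclic F G₁ P ψ₁-iso) ,
    (λ cyclic → equivalent-to-costas-polynomial G₁ G₂ cyclic card₁≡order zpm φ φ-costas)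
    where
    card₁≡order : FinAbGroup.card G₁ ≡ order
    card₁≡order = ℕ.suc-injective (trans (ℕ.+-comm 1 _)
      (trans (proj₁ (proj₁ φ-costas)) (trans (Homomorphisms.IsoToZpm⇒card F G₂ zpm) p^m≡1+order)))

  one-to-one : (C E : FinAbGroup) → Cyclic C → FinAbGroup.card C ≡ p ^ m ∸ 1 → IsoToZpm p m E →
               Bijection (StdCostasMaps C E) (CostasPolysDeg< F (p ^ m))
  one-to-one C E cyclic card≡p^m-1 zpm =
    subst (λ q → Bijection (StdCostasMaps C E) (CostasPolysDeg< F q)) card≡p^m
      (correspondence C E cyclic cardC≡order zpm cardC+1≡cardE)
    where
    cardC≡order : FinAbGroup.card C ≡ order
    cardC≡order = trans card≡p^m-1 (cong (_∸ 1) p^m≡1+order)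
    cardC+1≡cardE : FinAbGroup.card C ℕ.+ 1 ≡ FinAbGroup.card E
    cardC+1≡cardE = trans (ℕ.+-comm _ 1) (trans (cong suc cardC≡order)
      (sym (trans (Homomorphisms.IsoToZpm⇒card F E zpm) p^m≡1+order)))

lemma5p2 : (p m : ℕ) → Prime p → 1 ≤ m
    → (F : FinField) → FinField.card F ≡ p ^ m
    → ((G₁ G₂ : FinAbGroup) (φ : ⟨ G₁ ⟩ → ⟨ G₂ ⟩)
         → IsStandardCircularCostas G₁ G₂ φ → IsoToZpm p m G₂
         → EquivToCostasPoly G₁ G₂ F φ ⇔′ Cyclic G₁)
    × ((C E : FinAbGroup) → Cyclic C → FinAbGroup.card C ≡ p ^ m ∸ 1
         → IsoToZpm p m E
         → Bijection (StdCostasMaps C E) (CostasPolysDeg< F (p ^ m)))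
lemma5p2 p m p-prime 1≤m F card≡p^m = equivalence , one-to-one
  where open CostasPolynomials F p-prime 1≤m card≡p^m
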